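{- (a) For every $n$ and every $\pi\in\mathsf{S}_n$ with nonempty strategic pile and ordered pair list $\sigma_\pi$, the merge graph $\mathscr{M}_\pi$ is an edge subgraph of the $\tau$-graph $\mathscr{T}_{\sigma_\pi}$ and contains no directed cycle. (b) Conversely, for every $k\ge1$, every $k$-cycle $\sigma^*$ on $\{1,\dots,k\}$, and every set $H$ of edges of the corresponding $\tau$-graph that contains no directed cycle, there exist $n$ and $\pi\in\mathsf{S}_n$ with $|\mathsf{SP}(\pi)|=k$, whose ordered pair list is encoded by $\sigma^*$, and whose merge graph has edge set exactly $H$.
   Context: $\mathsf{S}_n$: permutations of $\{1,\dots,n\}$, one-line notation $[a_1\cdots a_n]$; cycles $(c_1\cdots c_k)$ send $c_1\mapsto\cdots\mapsto c_k\mapsto c_1$; composition right-to-left. For $\pi=[a_1\cdots a_n]$ let $X_n=(0\;1\;\cdots\;n)$, $Y_\pi=(0\;a_n\;\cdots\;a_1)$, $C_\pi=Y_\pi\circ X_n$. If $0,n$ are in the same cycle of $C_\pi$, written $(0\;u_1\cdots u_j\;n\;b_1\cdots b_k)$, then $\mathsf{SP}(\pi)=\{b_1,\dots,b_k\}$ and $\mathsf{SP}^*(\pi)=(b_1,\dots,b_k)$; otherwise the pile is empty. For such $\pi$ with $k\ge1$, each $b_j$ ($2\le j\le k$) occurs in $\pi$ immediately to the left of $b_{j-1}+1$, and $\pi(n)=b_1$. Ordered pair list: listing the indices $j\in\{2,\dots,k\}$ in increasing order of the position of $b_j$ in $\pi$ as $x_1,\dots,x_{k-1}$, $\sigma_\pi=(b_{x_1},\dots,b_{x_{k-1}},b_1)$;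 it is encoded by the $k$-cycle $\sigma^*=(x_1\;\cdots\;x_{k-1}\;1)$ on $\{1,\dots,k\}$. With $\psi=(1\;2\;\cdots\;k)$ and $\tau_\sigma=\sigma^*\circ\psi$, the $\tau$-graph $\mathscr{T}_\sigma$ is the directed graph on $\{1,\dots,k\}$ with edges $(i,\tau_\sigma(i))$ for all $i$ with $\tau_\sigma(i)\ne i$. The merge graph $\mathscr{M}_\pi$ is the directed graph on $\{1,\dots,k\}$ with an edge $(i,j)$ iff $b_i+1=b_j$. -}

module Defs where

open import Data.Nat using (ℕ; zero; suc; _+_; _∸_; _≤_; _<_; _<?_; _≡ᵇ_)
open import Data.Fin using (Fin; zero; suc; toℕ; fromℕ; fromℕ<; inject₁)
open import Data.Fin.Permutation using (Permutation′; _⟨$⟩ʳ_; _⟨$⟩ˡ_)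
open import Data.Bool using (if_then_else_)
open import Data.List using (List; []; _∷_; _++_; [_]; map; upTo)
open import Data.List.Relation.Unary.Linked using (Linked)
open import Data.List.Relation.Unary.AllPairs using (AllPairs)
open import Data.List.Relation.Unary.Unique.Propositional using (Unique)
open import Data.List.Relation.Binary.Permutation.Propositional using (_↭_)
open import Data.Product using (_×_)
open import Data.Empty using (⊥)
open import Relation.Nullary using (¬_; yes; no)
open import Relation.Binary.PropositionalEquality using (_≡_)

-- Positions 1..n are Fin n (position p+1 ↔ p), and the one-line entry
-- a_{p+1} = 1 + toℕ (π ⟨$⟩ʳ p).  The ground set {0,1,…,n} of X_n, Y_π, C_π is
-- Fin (suc n) (element v ↔ the Fin element with toℕ = v); so the value a_{p+1}
-- is the element  suc (π ⟨$⟩ʳ p) .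

iter : {A : Set} → (A → A) → ℕ → A → A
iter f zero    x = x
iter f (suc m) x = f (iter f m x)

entry : {n : ℕ} → Permutation′ n → Fin n → Fin (suc n)
entry π p = suc (π ⟨$⟩ʳ p)

-- X_n = (0 1 ⋯ n)
Xn : (n : ℕ) → Fin (suc n) → Fin (suc n)
Xn n x with toℕ x <? n
... | yes lt = fromℕ< (Data.Nat.s≤s lt)
... | no  _  = zero

-- Y_π = (0 a_n a_{n-1} ⋯ a_1)
Yπ : {n : ℕ} → Permutation′ n → Fin (suc n) → Fin (suc n)
Yπ {zero}  π zero    = zero
Yπ {suc m} π zero    = entry π (fromℕ m)
Yπ {n}     π (suc w) with π ⟨$⟩ˡ w                -- w+1 = a_{p+1}
... | zero  = zero                                 -- a_1 ↦ 0
... | suc q = entry π (inject₁ q)                  -- a_{q+2} ↦ a_{q+1}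

Cπ : {n : ℕ} → Permutation′ n → Fin (suc n) → Fin (suc n)
Cπ {n} π x = Yπ π (Xn n x)

Citer : {n : ℕ} → Permutation′ n → ℕ → Fin (suc n)
Citer {n} π i = iter (Cπ π) i (fromℕ n)

-- The strategic pile of π is (b_1,…,b_k) with b_i = C_π^i(n), where k is such that
-- C_π^{k+1}(n) = 0 and C_π^i(n) ≠ 0 for 1 ≤ i ≤ k, i.e. the cycle of C_π through
-- 0 is (0 u_1 ⋯ u_j n b_1 ⋯ b_k).  `PileSize π k` says 0,n lie in one cycle and
-- the strategic pile SP*(π) has exactly k entries.
PileSize : {n : ℕ} → Permutation′ n → ℕ → Set
PileSize π k = (Citer π (suc k) ≡ zero) × (∀ i → 1 ≤ i → i ≤ k → ¬ (Citer π i ≡ zero))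

b : {n : ℕ} → Permutation′ n → ℕ → ℕ
b π i = toℕ (Citer π i)

-- position (0-based) in π of a value v ∈ {1..n}; junk 0 for v = 0
posV : {n : ℕ} → Permutation′ n → Fin (suc n) → ℕ
posV π zero    = 0
posV π (suc w) = toℕ (π ⟨$⟩ˡ w)

posB : {n : ℕ} → Permutation′ n → ℕ → ℕ
posB π j = posV π (Citer π j)

from2to : ℕ → List ℕ
from2to k = map (2 +_) (upTo (k ∸ 1))

-- Then
-- σ_π = (b_{x_1},…,b_{x_{k-1}},b_1) and σ* = (x_1 ⋯ x_{k-1} 1).
OrderedPairList : {n : ℕ} → Permutation′ n → ℕ → List ℕ → Set
OrderedPairList π k xs = (xs ↭ from2to k) × AllPairs (λ x y → posB π x < posB π y) xs

nextIn : ℕ → List ℕ → ℕ → ℕ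
nextIn f []           x = x
nextIn f (c ∷ [])     x = if x ≡ᵇ c then f else x
nextIn f (c ∷ d ∷ cs) x = if x ≡ᵇ c then d else nextIn f (d ∷ cs) x

cycleOf : List ℕ → ℕ → ℕ
cycleOf []       x = x
cycleOf (c ∷ cs) x = nextIn c (c ∷ cs) x

σstar : List ℕ → ℕ → ℕ
σstar xs = cycleOf (xs ++ [ 1 ])

ψ : ℕ → ℕ → ℕ
ψ k = cycleOf (map suc (upTo k))

τ : ℕ → List ℕ → ℕ → ℕ
τ k xs i = σstar xs (ψ k i)

TauEdge : ℕ → List ℕ → ℕ → ℕ → Set
TauEdge k xs i j = (1 ≤ i) × (i ≤ k) × (τ k xs i ≡ j) × ¬ (τ k xs i ≡ i)

MergeEdge : {n : ℕ} → Permutation′ n → ℕ → ℕ → ℕ → Set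
MergeEdge π k i j = (1 ≤ i) × (i ≤ k) × (1 ≤ j) × (j ≤ k) × (b π i + 1 ≡ b π j)

DirectedCycle : (ℕ → ℕ → Set) → List ℕ → Set
DirectedCycle E []       = ⊥
DirectedCycle E (v ∷ vs) = Unique (v ∷ vs) × Linked E ((v ∷ vs) ++ [ v ])

HasDirectedCycle : (ℕ → ℕ → Set) → Set
HasDirectedCycle E = Data.Product.∃ (λ vs → DirectedCycle E vs)

module Submission where

-- (a) If b j = b i + 1, then C_π (b i) = Y_π (b j) is the entry just left of b j, so b (i + 1)
-- and b j are neighbours in π (or b j comes first and i = k).  As σ* lists the pile indices in
-- the order of their positions in π, τ = σ* ∘ ψ sends i to j.  Along a merge edge b grows by
-- one, so the merge graph has no directed cycle.
-- (b) An acyclic set H of τ-edges is a union of disjoint τ-paths.  Labelling every vertex by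
-- (root of its path + 1) · K + (its depth) turns H into exactly the pairs of consecutive labels,
-- and the labels can be written into a one-line notation in which C_π steps from label i to
-- label (i + 1) while the indices 2, …, k occur in the order prescribed by σ*.

open import Defs
open import Data.Nat using (ℕ; zero; suc; _+_; _*_; _∸_; _≤_; _<_; z≤n; s≤s; _≟_; _<?_; _≤?_; _≡ᵇ_; NonZero)
open import Data.Nat.Properties
open import Data.Nat.DivMod using (_%_; _/_; m≡m%n+[m/n]*n; m%n<n; [m+kn]%n≡m%n; m<n⇒m%n≡m)
open import Data.Bool using (true; false)
open import Data.Empty using (⊥; ⊥-elim)
open import Data.Fin as Fin using (Fin; toℕ; fromℕ; fromℕ<; inject₁)
open import Data.Fin.Properties using (toℕ-fromℕ; toℕ-fromℕ<; toℕ-inject₁; toℕ-injective; toℕ<n; fromℕ<-cong; pigeonhole) renaming (suc-injective to Fin-suc-injective)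
open import Data.Fin.Permutation using (Permutation′; _⟨$⟩ʳ_; _⟨$⟩ˡ_; inverseˡ; inverseʳ; permutation)
open import Data.Maybe using (Maybe; just; nothing)
open import Data.List using (List; []; _∷_; _++_; [_]; map; length; upTo; applyUpTo; concat; concatMap; filter)
open import Data.List.Properties using (length-++; length-map; length-upTo; length-applyUpTo; ++-assoc; ++-identityʳ; upTo-∷ʳ; map-++; concat-++)
open import Data.List.Membership.Propositional using (_∈_; _∉_; lose; find)
open import Data.List.Membership.Propositional.Properties using (∈-++⁺ˡ; ∈-++⁺ʳ; ∈-++⁻; ∈-map⁺; ∈-map⁻; ∈-upTo⁺; ∈-upTo⁻; ∈-filter⁺; ∈-filter⁻; ∈-concatMap⁺; ∈-concatMap⁻)
open import Data.List.Membership.DecPropositional _≟_ using (_∈?_)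
open import Data.List.Relation.Unary.Any using (here; there)
open import Data.List.Relation.Unary.All as All using (All; []; _∷_)
open import Data.List.Relation.Unary.AllPairs using (AllPairs; []; _∷_; allPairs?)
open import Data.List.Relation.Unary.AllPairs.Properties as AllPairsP using ()
open import Data.List.Relation.Unary.Linked using (Linked; []; [-]; _∷_)
open import Data.List.Relation.Unary.Linked.Properties as LinkedP using ()
open import Data.List.Relation.Unary.All.Properties as AllP using ()
open import Data.List.Relation.Unary.Unique.Propositional using (Unique)
open import Data.List.Relation.Unary.Unique.Propositional.Properties as Unique using (upTo⁺)
open import Data.List.Relation.Binary.Permutation.Propositional using (_↭_; ↭-sym; ↭⇒↭ₛ)
open import Data.List.Relation.Binary.Permutation.Propositional.Properties using (∈-resp-↭; ↭-length)
open import Data.List.Relation.Binary.Permutation.Setoid.Properties as Permutationₛ using ()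
open import Data.List.Membership.Propositional.Properties.WithK using (unique∧set⇒bag)
open import Data.List.Relation.Binary.BagAndSetEquality using (∼bag⇒↭)
open import Data.Product using (Σ; _×_; _,_; proj₁; proj₂)
open import Data.Sum using (_⊎_; inj₁; inj₂)
open import Function.Bundles using (_⇔_; mk⇔)
open import Relation.Nullary using (¬_; Dec; yes; no; ¬?)
open import Relation.Nullary.Decidable using (decidable-stable)
open import Relation.Binary.PropositionalEquality hiding ([_])

suc-pred≥1 : ∀ {v} → 1 ≤ v → suc (v ∸ 1) ≡ v
suc-pred≥1 = m+[n∸m]≡n

nth : List ℕ → ℕ → ℕ
nth []       _       = 0
nth (x ∷ xs) zero    = x
nth (x ∷ xs) (suc p) = nth xs p

indexOf : ℕ → List ℕ → ℕ
indexOf v [] = 0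
indexOf v (x ∷ xs) with v ≟ x
... | yes _ = 0
... | no  _ = suc (indexOf v xs)

nth-++ˡ : ∀ P S p → p < length P → nth (P ++ S) p ≡ nth P p
nth-++ˡ (x ∷ P) S zero    _         = refl
nth-++ˡ (x ∷ P) S (suc p) (s≤s p<) = nth-++ˡ P S p p<

nth-++ʳ : ∀ P S p → nth (P ++ S) (length P + p) ≡ nth S p
nth-++ʳ []      S p = refl
nth-++ʳ (x ∷ P) S p = nth-++ʳ P S p

nth-++-∷ : ∀ P x S → nth (P ++ x ∷ S) (length P) ≡ x
nth-++-∷ P x S = trans (cong (nth (P ++ x ∷ S)) (sym (+-identityʳ (length P)))) (nth-++ʳ P (x ∷ S) 0)

nth∈ : ∀ L p → p < length L → nth L p ∈ L
nth∈ (x ∷ L) zero    _         = here refl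
nth∈ (x ∷ L) (suc p) (s≤s p<) = there (nth∈ L p p<)

nth-map : ∀ (f : ℕ → ℕ) L p → p < length L → nth (map f L) p ≡ f (nth L p)
nth-map f (x ∷ L) zero    _         = refl
nth-map f (x ∷ L) (suc p) (s≤s p<) = nth-map f L p p<

nth-applyUpTo : ∀ (f : ℕ → ℕ) n p → p < n → nth (applyUpTo f n) p ≡ f p
nth-applyUpTo f (suc n) zero    _         = refl
nth-applyUpTo f (suc n) (suc p) (s≤s p<) = nth-applyUpTo (λ z → f (suc z)) n p p<

nth-upTo : ∀ k p → p < k → nth (upTo k) p ≡ p
nth-upTo = nth-applyUpTo (λ z → z)

indexOf-head : ∀ x S → indexOf x (x ∷ S) ≡ 0
indexOf-head x S with x ≟ x
... | yes _ = refl
... | no ne = ⊥-elim (ne refl)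

indexOf-++ʳ : ∀ {x} P S → x ∉ P → indexOf x (P ++ S) ≡ length P + indexOf x S
indexOf-++ʳ []          S _  = refl
indexOf-++ʳ {x} (y ∷ P) S x∉ with x ≟ y
... | yes x≡y = ⊥-elim (x∉ (here x≡y))
... | no  _   = cong suc (indexOf-++ʳ P S (λ x∈ → x∉ (there x∈)))

indexOf-++-∷ : ∀ {x} P S → x ∉ P → indexOf x (P ++ x ∷ S) ≡ length P
indexOf-++-∷ {x} P S x∉ = begin
  indexOf x (P ++ x ∷ S)        ≡⟨ indexOf-++ʳ P (x ∷ S) x∉ ⟩
  length P + indexOf x (x ∷ S)  ≡⟨ cong (length P +_) (indexOf-head x S) ⟩
  length P + 0                  ≡⟨ +-identityʳ _ ⟩
  length P                      ∎
  where open ≡-Reasoning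

nth-indexOf : ∀ {x} L → x ∈ L → nth L (indexOf x L) ≡ x
nth-indexOf {x} (y ∷ L) x∈ with x ≟ y
nth-indexOf {x} (y ∷ L) x∈         | yes x≡y = sym x≡y
nth-indexOf {x} (y ∷ L) (here x≡y) | no  x≢y = ⊥-elim (x≢y x≡y)
nth-indexOf {x} (y ∷ L) (there x∈) | no  _   = nth-indexOf L x∈

indexOf<length : ∀ {x} L → x ∈ L → indexOf x L < length L
indexOf<length {x} (y ∷ L) x∈ with x ≟ y
indexOf<length {x} (y ∷ L) x∈         | yes _   = s≤s z≤n
indexOf<length {x} (y ∷ L) (here x≡y) | no  x≢y = ⊥-elim (x≢y x≡y)
indexOf<length {x} (y ∷ L) (there x∈) | no  _   = s≤s (indexOf<length L x∈)

indexOf-nth : ∀ L p → Unique L → p < length L → indexOf (nth L p) L ≡ p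
indexOf-nth (x ∷ L) zero    _          _         = indexOf-head x L
indexOf-nth (x ∷ L) (suc p) (x∉ ∷ uL) (s≤s p<) with nth L p ≟ x
... | yes eq = ⊥-elim (All.lookup x∉ (nth∈ L p p<) (sym eq))
... | no  _  = cong suc (indexOf-nth L p uL p<)

nth-injective : ∀ L p q → Unique L → p < length L → q < length L → nth L p ≡ nth L q → p ≡ q
nth-injective L p q uL p< q< eq =
  trans (sym (indexOf-nth L p uL p<)) (trans (cong (λ z → indexOf z L) eq) (indexOf-nth L q uL q<))

∈⇒nth : ∀ {x} L → x ∈ L → Σ ℕ (λ p → (p < length L) × (nth L p ≡ x))
∈⇒nth L x∈ = indexOf _ L , indexOf<length L x∈ , nth-indexOf L x∈

∈⇒firstSplit : ∀ {x} L → x ∈ L → Σ (List ℕ) (λ P → Σ (List ℕ) (λ S → (L ≡ P ++ x ∷ S) × x ∉ P))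
∈⇒firstSplit {x} (y ∷ L) x∈ with x ≟ y
∈⇒firstSplit {x} (x ∷ L) x∈         | yes refl = [] , L , refl , λ ()
∈⇒firstSplit {x} (y ∷ L) (here x≡y) | no  x≢y  = ⊥-elim (x≢y x≡y)
∈⇒firstSplit {x} (y ∷ L) (there x∈) | no  x≢y  with ∈⇒firstSplit L x∈
... | P , S , refl , x∉P = y ∷ P , S , refl , λ { (here x≡y) → x≢y x≡y ; (there x∈P) → x∉P x∈P }

splitAt-nth : ∀ L s → s < length L → Σ (List ℕ) (λ P → Σ (List ℕ) (λ S → (L ≡ P ++ nth L s ∷ S) × (length P ≡ s)))
splitAt-nth (x ∷ L) zero    _         = [] , L , refl , refl
splitAt-nth (x ∷ L) (suc s) (s≤s s<) with splitAt-nth L s s<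
... | P , S , eq , len = x ∷ P , S , cong (x ∷_) eq , cong suc len

Unique-++-∷⇒∉ : ∀ P (x : ℕ) S → Unique (P ++ x ∷ S) → x ∉ P
Unique-++-∷⇒∉ (p ∷ P) x S (p∉ ∷ _)  (here refl) = All.lookup p∉ (∈-++⁺ʳ P (here refl)) refl
Unique-++-∷⇒∉ (p ∷ P) x S (_  ∷ uL) (there x∈)  = Unique-++-∷⇒∉ P x S uL x∈

Unique-++⇒disjoint : ∀ P S → Unique (P ++ S) → ∀ {z : ℕ} → z ∈ P → z ∉ S
Unique-++⇒disjoint (p ∷ P) S (p∉ ∷ _)  (here refl) z∈S = All.lookup p∉ (∈-++⁺ʳ P z∈S) refl
Unique-++⇒disjoint (p ∷ P) S (_  ∷ uL) (there z∈P) z∈S = Unique-++⇒disjoint P S uL z∈P z∈S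

Unique-++⁻ˡ : ∀ (P S : List ℕ) → Unique (P ++ S) → Unique P
Unique-++⁻ˡ []      S _          = []
Unique-++⁻ˡ (p ∷ P) S (p∉ ∷ uL) = All.tabulate (λ z∈ → All.lookup p∉ (∈-++⁺ˡ z∈)) ∷ Unique-++⁻ˡ P S uL

Unique-resp-↭ : ∀ {xs ys : List ℕ} → xs ↭ ys → Unique xs → Unique ys
Unique-resp-↭ p = Permutationₛ.Unique-resp-↭ (setoid ℕ) (↭⇒↭ₛ p)

indexOf-++-< : ∀ {v w} P S → Unique (P ++ S) → v ∈ P → w ∈ S → indexOf v (P ++ S) < indexOf w (P ++ S)
indexOf-++-< {v} {w} P S uPS v∈ w∈ = <-≤-trans (before P v∈) after
  where
  before : ∀ P → v ∈ P → indexOf v (P ++ S) < length P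
  before (p ∷ P) v∈ with v ≟ p
  before (p ∷ P) v∈         | yes _   = s≤s z≤n
  before (p ∷ P) (here v≡p) | no  v≢p = ⊥-elim (v≢p v≡p)
  before (p ∷ P) (there v∈) | no  _   = s≤s (before P v∈)
  after : length P ≤ indexOf w (P ++ S)
  after = subst (length P ≤_) (sym (indexOf-++ʳ P S (λ w∈P → Unique-++⇒disjoint P S uPS w∈P w∈))) (m≤m+n _ _)

AllPairs-byIndex : ∀ {R : ℕ → ℕ → Set} L → (∀ p q → p < q → q < length L → R (nth L p) (nth L q)) → AllPairs R L
AllPairs-byIndex []      _ = []
AllPairs-byIndex {R} (x ∷ L) h =
  headPairs L (λ q q< → h 0 (suc q) (s≤s z≤n) (s≤s q<)) ∷
  AllPairs-byIndex L (λ p q p<q q< → h (suc p) (suc q) (s≤s p<q) (s≤s q<))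
  where
  headPairs : ∀ M → (∀ q → q < length M → R x (nth M q)) → All (R x) M
  headPairs []      _ = []
  headPairs (y ∷ M) g = g 0 (s≤s z≤n) ∷ headPairs M (λ q q< → g (suc q) (s≤s q<))

≡ᵇ-refl : ∀ x → (x ≡ᵇ x) ≡ true
≡ᵇ-refl zero    = refl
≡ᵇ-refl (suc x) = ≡ᵇ-refl x

≢⇒≡ᵇ-false : ∀ x c → ¬ x ≡ c → (x ≡ᵇ c) ≡ false
≢⇒≡ᵇ-false zero    zero    x≢c = ⊥-elim (x≢c refl)
≢⇒≡ᵇ-false zero    (suc c) _   = refl
≢⇒≡ᵇ-false (suc x) zero    _   = refl
≢⇒≡ᵇ-false (suc x) (suc c) x≢c = ≢⇒≡ᵇ-false x c (λ x≡c → x≢c (cong suc x≡c))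

nextIn-skip : ∀ f c d cs x → ¬ x ≡ c → nextIn f (c ∷ d ∷ cs) x ≡ nextIn f (d ∷ cs) x
nextIn-skip f c d cs x x≢c rewrite ≢⇒≡ᵇ-false x c x≢c = refl

nextIn-++-∷-∷ : ∀ f P x y S → x ∉ P → nextIn f (P ++ x ∷ y ∷ S) x ≡ y
nextIn-++-∷-∷ f []          x y S _  rewrite ≡ᵇ-refl x = refl
nextIn-++-∷-∷ f (p ∷ [])    x y S x∉ =
  trans (nextIn-skip f p x (y ∷ S) x (λ x≡p → x∉ (here x≡p))) (nextIn-++-∷-∷ f [] x y S λ ())
nextIn-++-∷-∷ f (p ∷ q ∷ P) x y S x∉ =
  trans (nextIn-skip f p q (P ++ x ∷ y ∷ S) x (λ x≡p → x∉ (here x≡p)))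
        (nextIn-++-∷-∷ f (q ∷ P) x y S (λ x∈ → x∉ (there x∈)))

nextIn-++-last : ∀ f P x → x ∉ P → nextIn f (P ++ [ x ]) x ≡ f
nextIn-++-last f []          x _  rewrite ≡ᵇ-refl x = refl
nextIn-++-last f (p ∷ [])    x x∉ =
  trans (nextIn-skip f p x [] x (λ x≡p → x∉ (here x≡p))) (nextIn-++-last f [] x λ ())
nextIn-++-last f (p ∷ q ∷ P) x x∉ =
  trans (nextIn-skip f p q (P ++ [ x ]) x (λ x≡p → x∉ (here x≡p)))
        (nextIn-++-last f (q ∷ P) x (λ x∈ → x∉ (there x∈)))

cycleOf-++-∷-∷ : ∀ P x y S → x ∉ P → cycleOf (P ++ x ∷ y ∷ S) x ≡ y
cycleOf-++-∷-∷ []      x = nextIn-++-∷-∷ x [] x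
cycleOf-++-∷-∷ (p ∷ P) = nextIn-++-∷-∷ p (p ∷ P)

cycleOf-++-last : ∀ L P x → L ≡ P ++ [ x ] → x ∉ P → cycleOf L x ≡ nth L 0
cycleOf-++-last _ []      x refl _  = nextIn-++-last x [] x λ ()
cycleOf-++-last _ (p ∷ P) x refl x∉ = nextIn-++-last p (p ∷ P) x x∉

cycleOf-nth : ∀ L s → Unique L → suc s < length L → cycleOf L (nth L s) ≡ nth L (suc s)
cycleOf-nth L s uL s+1< with splitAt-nth L s (<-trans (n<1+n s) s+1<)
... | P , [] , eq , refl = ⊥-elim (<-irrefl refl (subst (suc (length P) <_) lenL s+1<))
  where
  lenL : length L ≡ suc (length P)
  lenL = trans (cong length eq) (trans (length-++ P) (+-comm (length P) 1))
... | P , y ∷ S , eq , refl =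
  trans (cong (λ M → cycleOf M x) eq) (trans (cycleOf-++-∷-∷ P x y S x∉P) (sym nth-y))
  where
  x = nth L (length P)
  x∉P : x ∉ P
  x∉P = Unique-++-∷⇒∉ P x (y ∷ S) (subst Unique eq uL)
  nth-y : nth L (suc (length P)) ≡ y
  nth-y = trans (cong (λ M → nth M (suc (length P))) eq)
                (trans (cong (nth (P ++ x ∷ y ∷ S)) (+-comm 1 (length P))) (nth-++ʳ P (x ∷ y ∷ S) 1))

cycleOf-nth-last : ∀ L s → Unique L → suc s ≡ length L → cycleOf L (nth L s) ≡ nth L 0
cycleOf-nth-last L s uL s+1≡ with splitAt-nth L s (≤-reflexive s+1≡)
... | P , [] , eq , _ =
  cycleOf-++-last L P (nth L s) eq (Unique-++-∷⇒∉ P _ [] (subst Unique eq uL))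
... | P , y ∷ S , eq , refl = ⊥-elim (0≢1+n (suc-injective (+-cancelˡ-≡ (length P) 1 _ lenL)))
  where
  lenL : length P + 1 ≡ length P + suc (suc (length S))
  lenL = trans (+-comm (length P) 1) (trans s+1≡ (trans (cong length eq) (length-++ P)))

oneTo : ℕ → List ℕ
oneTo k = map suc (upTo k)

length-oneTo : ∀ k → length (oneTo k) ≡ k
length-oneTo k = trans (length-map suc (upTo k)) (length-upTo k)

nth-oneTo : ∀ k p → p < k → nth (oneTo k) p ≡ suc p
nth-oneTo k p p< =
  trans (nth-map suc (upTo k) p (subst (p <_) (sym (length-upTo k)) p<)) (cong suc (nth-upTo k p p<))

Unique-oneTo : ∀ k → Unique (oneTo k)
Unique-oneTo k = Unique.map⁺ suc-injective (upTo⁺ k)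

ψ-suc : ∀ k i → 1 ≤ i → i < k → ψ k i ≡ suc i
ψ-suc k (suc i) _ i+1<k = begin
  cycleOf (oneTo k) (suc i)               ≡⟨ cong (cycleOf (oneTo k)) (sym (nth-oneTo k i (<-trans (n<1+n _) i+1<k))) ⟩
  cycleOf (oneTo k) (nth (oneTo k) i)     ≡⟨ cycleOf-nth (oneTo k) i (Unique-oneTo k) (subst (suc i <_) (sym (length-oneTo k)) i+1<k) ⟩
  nth (oneTo k) (suc i)                   ≡⟨ nth-oneTo k (suc i) i+1<k ⟩
  suc (suc i)                             ∎
  where open ≡-Reasoning

ψ-last : ∀ k → 1 ≤ k → ψ k k ≡ 1
ψ-last (suc k) _ = begin
  cycleOf (oneTo (suc k)) (suc k)              ≡⟨ cong (cycleOf (oneTo (suc k))) (sym (nth-oneTo (suc k) k ≤-refl)) ⟩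
  cycleOf (oneTo (suc k)) (nth (oneTo (suc k)) k) ≡⟨ cycleOf-nth-last (oneTo (suc k)) k (Unique-oneTo (suc k)) (sym (length-oneTo (suc k))) ⟩
  nth (oneTo (suc k)) 0                        ≡⟨ nth-oneTo (suc k) 0 (s≤s z≤n) ⟩
  1                                            ∎
  where open ≡-Reasoning

Unique-from2to : ∀ k → Unique (from2to k)
Unique-from2to k = Unique.map⁺ (λ {x} {y} → +-cancelˡ-≡ 2 x y) (upTo⁺ (k ∸ 1))

length-from2to : ∀ k → length (from2to k) ≡ k ∸ 1
length-from2to k = trans (length-map (2 +_) (upTo (k ∸ 1))) (length-upTo (k ∸ 1))

∈-from2to⁻ : ∀ k {j} → j ∈ from2to k → (2 ≤ j) × (j ≤ k)
∈-from2to⁻ k j∈ with ∈-map⁻ (2 +_) j∈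
... | x , x∈ , refl = s≤s (s≤s z≤n) , bound k (∈-upTo⁻ x∈)
  where
  bound : ∀ k → x < k ∸ 1 → 2 + x ≤ k
  bound (suc (suc k)) x< = s≤s (s≤s (≤-pred x<))

∈-from2to⁺ : ∀ k {j} → 2 ≤ j → j ≤ k → j ∈ from2to k
∈-from2to⁺ k {suc (suc j)} (s≤s (s≤s z≤n)) j≤k = ∈-map⁺ (2 +_) (∈-upTo⁺ (bound k j≤k))
  where
  bound : ∀ k → 2 + j ≤ k → j < k ∸ 1
  bound (suc (suc k)) (s≤s (s≤s j≤k)) = s≤s j≤k

-- With u = (k+1, x₁, …, x_{k-1}, 1), τ is the cyclic shift u t ∸ 1 ↦ u (suc t) of the
-- positions t < k, since σ* shifts xs ++ [ 1 ] and ψ k sends k = u 0 ∸ 1 to 1.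
module PairList (k : ℕ) (k≥1 : 1 ≤ k) (xs : List ℕ) (xs↭ : xs ↭ from2to k) where

  Unique-xs : Unique xs
  Unique-xs = Unique-resp-↭ (↭-sym xs↭) (Unique-from2to k)

  length-xs : length xs ≡ k ∸ 1
  length-xs = trans (↭-length xs↭) (length-from2to k)

  ∈-xs⁻ : ∀ {j} → j ∈ xs → (2 ≤ j) × (j ≤ k)
  ∈-xs⁻ j∈ = ∈-from2to⁻ k (∈-resp-↭ xs↭ j∈)

  ∈-xs⁺ : ∀ {j} → 2 ≤ j → j ≤ k → j ∈ xs
  ∈-xs⁺ 2≤j j≤k = ∈-resp-↭ (↭-sym xs↭) (∈-from2to⁺ k 2≤j j≤k)

  1∉xs : 1 ∉ xs
  1∉xs 1∈ with ∈-xs⁻ 1∈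
  ... | s≤s () , _

  length-xs1 : length (xs ++ [ 1 ]) ≡ k
  length-xs1 = trans (length-++ xs) (trans (+-comm (length xs) 1) (trans (cong suc length-xs) (suc-pred≥1 k≥1)))

  Unique-xs1 : Unique (xs ++ [ 1 ])
  Unique-xs1 = Unique.++⁺ Unique-xs ([] ∷ []) (λ { (1∈ , here refl) → 1∉xs 1∈ })

  U : List ℕ
  U = suc k ∷ xs ++ [ 1 ]

  u : ℕ → ℕ
  u t = nth U t

  Unique-U : Unique U
  Unique-U = All.tabulate k+1∉ ∷ Unique-xs1
    where
    k+1∉ : ∀ {v} → v ∈ xs ++ [ 1 ] → ¬ suc k ≡ v
    k+1∉ v∈ refl with ∈-++⁻ xs v∈
    ... | inj₁ v∈xs        = 1+n≰n (proj₂ (∈-xs⁻ v∈xs))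
    ... | inj₂ (here k+1≡1) = <-irrefl (sym (suc-injective k+1≡1)) k≥1

  u-last : u k ≡ 1
  u-last = begin
    nth U k                           ≡⟨ cong (nth U) (sym (trans (cong suc length-xs) (suc-pred≥1 k≥1))) ⟩
    nth (xs ++ [ 1 ]) (length xs)     ≡⟨ nth-++-∷ xs 1 [] ⟩
    1                                 ∎
    where open ≡-Reasoning

  u-xs : ∀ t → t < k ∸ 1 → u (suc t) ≡ nth xs t
  u-xs t t< = nth-++ˡ xs [ 1 ] t (subst (t <_) (sym length-xs) t<)

  u-inner-range : ∀ t → 1 ≤ t → t < k → (2 ≤ u t) × (u t ≤ k)
  u-inner-range (suc t) _ t+1<k = subst (λ v → (2 ≤ v) × (v ≤ k)) (sym (u-xs t t<)) (∈-xs⁻ (nth∈ xs t (subst (t <_) (sym length-xs) t<)))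
    where
    t< : t < k ∸ 1
    t< = ∸-monoˡ-≤ 1 t+1<k

  u-injective : ∀ t t′ → t ≤ k → t′ ≤ k → u t ≡ u t′ → t ≡ t′
  u-injective t t′ t≤ t′≤ = nth-injective U t t′ Unique-U (s≤s (subst (t ≤_) (sym length-xs1) t≤)) (s≤s (subst (t′ ≤_) (sym length-xs1) t′≤))

  1≤u : ∀ t → t ≤ k → 1 ≤ u t
  1≤u zero    _   = s≤s z≤n
  1≤u (suc t) t<k with suc t ≟ k
  ... | yes refl  = ≤-reflexive (sym u-last)
  ... | no  t+1≢k = ≤-trans (s≤s z≤n) (proj₁ (u-inner-range (suc t) (s≤s z≤n) (≤∧≢⇒< t<k t+1≢k)))

  u-suc-range : ∀ t → t < k → (1 ≤ u (suc t)) × (u (suc t) ≤ k)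
  u-suc-range t t<k with suc t ≟ k
  ... | yes t+1≡k = subst (λ v → (1 ≤ v) × (v ≤ k)) (sym (trans (cong u t+1≡k) u-last)) (s≤s z≤n , k≥1)
  ... | no  t+1≢k with u-inner-range (suc t) (s≤s z≤n) (≤∧≢⇒< t<k t+1≢k)
  ...   | 2≤u , u≤k = ≤-trans (s≤s z≤n) 2≤u , u≤k

  u-pred-range : ∀ t → t < k → (1 ≤ u t ∸ 1) × (u t ∸ 1 ≤ k)
  u-pred-range zero    _    = k≥1 , ≤-refl
  u-pred-range (suc t) t<k with u-inner-range (suc t) (s≤s z≤n) t<k
  ... | 2≤u , u≤k = ∸-monoˡ-≤ 1 2≤u , ≤-trans (∸-monoˡ-≤ 1 u≤k) (m∸n≤m k 1)

  τ-u : ∀ t → t < k → τ k xs (u t ∸ 1) ≡ u (suc t)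
  τ-u zero _ = begin
    σstar xs (ψ k k)                               ≡⟨ cong (σstar xs) (ψ-last k k≥1) ⟩
    cycleOf (xs ++ [ 1 ]) 1                        ≡⟨ cycleOf-++-last (xs ++ [ 1 ]) xs 1 refl 1∉xs ⟩
    nth (xs ++ [ 1 ]) 0                            ∎
    where open ≡-Reasoning
  τ-u (suc t) t+1<k with u-inner-range (suc t) (s≤s z≤n) t+1<k
  ... | 2≤u , u≤k = begin
    σstar xs (ψ k (v ∸ 1))                         ≡⟨ cong (σstar xs) (ψ-suc k (v ∸ 1) (∸-monoˡ-≤ 1 2≤u) (<-≤-trans (n∸1<n 1≤v) u≤k)) ⟩
    σstar xs (suc (v ∸ 1))                         ≡⟨ cong (σstar xs) (suc-pred≥1 1≤v) ⟩
    cycleOf (xs ++ [ 1 ]) (nth (xs ++ [ 1 ]) t)    ≡⟨ cycleOf-nth (xs ++ [ 1 ]) t Unique-xs1 (subst (suc t <_) (sym length-xs1) t+1<k) ⟩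
    nth (xs ++ [ 1 ]) (suc t)                      ∎
    where
    open ≡-Reasoning
    v = u (suc t)
    1≤v : 1 ≤ v
    1≤v = ≤-trans (s≤s z≤n) 2≤u
    n∸1<n : ∀ {n} → 1 ≤ n → n ∸ 1 < n
    n∸1<n (s≤s _) = ≤-refl

  u-covers : ∀ i → 1 ≤ i → i ≤ k → Σ ℕ (λ t → (t < k) × (u t ≡ suc i))
  u-covers i 1≤i i≤k with i ≟ k
  ... | yes refl = 0 , ≤-trans (s≤s z≤n) k≥1 , refl
  ... | no  i≢k with ∈⇒nth xs (∈-xs⁺ (s≤s 1≤i) (≤∧≢⇒< i≤k i≢k))
  ...   | s , s< , nth≡ = suc s , s+1<k , trans (u-xs s s<′) nth≡
    where
    s<′ : s < k ∸ 1
    s<′ = subst (s <_) length-xs s<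
    s+1<k : suc s < k
    s+1<k = subst (suc s <_) (suc-pred≥1 k≥1) (s≤s s<′)

  τ-at : ∀ i t → u t ≡ suc i → t < k → τ k xs i ≡ u (suc t)
  τ-at i t ut≡ t<k = subst (λ z → τ k xs z ≡ u (suc t)) (cong (_∸ 1) ut≡) (τ-u t t<k)

  τ-range : ∀ i → 1 ≤ i → i ≤ k → (1 ≤ τ k xs i) × (τ k xs i ≤ k)
  τ-range i 1≤i i≤k with u-covers i 1≤i i≤k
  ... | t , t<k , ut≡ = subst (λ v → (1 ≤ v) × (v ≤ k)) (sym (τ-at i t ut≡ t<k)) (u-suc-range t t<k)

  τ-injective : ∀ i i′ → 1 ≤ i → i ≤ k → 1 ≤ i′ → i′ ≤ k → τ k xs i ≡ τ k xs i′ → i ≡ i′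
  τ-injective i i′ 1≤i i≤k 1≤i′ i′≤k τ≡ with u-covers i 1≤i i≤k | u-covers i′ 1≤i′ i′≤k
  ... | t , t<k , ut≡ | t′ , t′<k , ut′≡ = suc-injective (trans (sym ut≡) (trans (cong u t≡t′) ut′≡))
    where
    t≡t′ : t ≡ t′
    t≡t′ = suc-injective (u-injective (suc t) (suc t′) t<k t′<k
             (trans (sym (τ-at i t ut≡ t<k)) (trans τ≡ (τ-at i′ t′ ut′≡ t′<k))))

Xn-top : ∀ n → Xn n (fromℕ n) ≡ Fin.zero
Xn-top n with toℕ (fromℕ n) <? n
... | yes n< = ⊥-elim (<-irrefl (toℕ-fromℕ n) n<)
... | no  _  = refl

Xn-< : ∀ n (x : Fin (suc n)) (x<n : toℕ x < n) → Xn n x ≡ Fin.suc (fromℕ< x<n)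
Xn-< n x x<n with toℕ x <? n
... | yes x<n′ = cong Fin.suc (fromℕ<-cong _ _ refl x<n′ x<n)
... | no  x≮n  = ⊥-elim (x≮n x<n)

Xn≡zero⇒top : ∀ n (x : Fin (suc n)) → Xn n x ≡ Fin.zero → toℕ x ≡ n
Xn≡zero⇒top n x Xx≡0 with toℕ x <? n
... | no x≮n = ≤-antisym (≤-pred (toℕ<n x)) (≮⇒≥ x≮n)

Cπ-top : ∀ m (π : Permutation′ (suc m)) → Cπ π (fromℕ (suc m)) ≡ entry π (fromℕ m)
Cπ-top m π rewrite Xn-top (suc m) = refl

Citer-empty : ∀ (π : Permutation′ 0) → Citer π 1 ≡ Fin.zero
Citer-empty π rewrite Xn-top 0 = refl

Yπ-first : ∀ {n} (π : Permutation′ (suc n)) w → π ⟨$⟩ˡ w ≡ Fin.zero → Yπ π (Fin.suc w) ≡ Fin.zero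
Yπ-first π w eq with π ⟨$⟩ˡ w
... | Fin.zero = refl

Yπ-next : ∀ {n} (π : Permutation′ (suc n)) w q → π ⟨$⟩ˡ w ≡ Fin.suc q → Yπ π (Fin.suc w) ≡ entry π (inject₁ q)
Yπ-next π w q eq with π ⟨$⟩ˡ w
Yπ-next π w q refl | Fin.suc .q = refl

Yπ≡a[n]⇒zero : ∀ m (π : Permutation′ (suc m)) v → Yπ π v ≡ entry π (fromℕ m) → v ≡ Fin.zero
Yπ≡a[n]⇒zero m π Fin.zero    _  = refl
Yπ≡a[n]⇒zero m π (Fin.suc w) eq with π ⟨$⟩ˡ w in π⁻¹w
... | Fin.suc q = ⊥-elim (<-irrefl (trans (sym (toℕ-inject₁ q)) (trans (cong toℕ q≡) (toℕ-fromℕ m))) (toℕ<n q))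
  where
  q≡ : inject₁ q ≡ fromℕ m
  q≡ = trans (sym (inverseˡ π)) (trans (cong (π ⟨$⟩ˡ_) (Fin-suc-injective eq)) (inverseˡ π))

nonzero⇒suc : ∀ {n} (x : Fin (suc n)) → ¬ x ≡ Fin.zero → Σ (Fin n) (λ w → x ≡ Fin.suc w)
nonzero⇒suc Fin.zero    x≢0 = ⊥-elim (x≢0 refl)
nonzero⇒suc (Fin.suc w) _   = w , refl

-- The permutation of Fin (suc m) whose one-line notation is a₁ ⋯ aₙ with a_{p+1} = 1 + nth M p.
module OneLine (m : ℕ) (M : List ℕ) (Unique-M : Unique M)
               (∈-M⁺ : ∀ v → v < suc m → v ∈ M) (∈-M⁻ : ∀ v → v ∈ M → v < suc m) where

  n : ℕ
  n = suc m

  length-M : length M ≡ n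
  length-M = trans (↭-length (∼bag⇒↭ (unique∧set⇒bag Unique-M (upTo⁺ n) (λ {v} → mk⇔ (λ v∈ → ∈-upTo⁺ (∈-M⁻ v v∈)) (λ v∈ → ∈-M⁺ v (∈-upTo⁻ v∈)))))) (length-upTo n)

  private
    p<length : ∀ (p : Fin n) → toℕ p < length M
    p<length p = subst (toℕ p <_) (sym length-M) (toℕ<n p)

    value : Fin n → Fin n
    value p = fromℕ< (∈-M⁻ _ (nth∈ M (toℕ p) (p<length p)))

    position : Fin n → Fin n
    position w = fromℕ< (subst (indexOf (toℕ w) M <_) length-M (indexOf<length M (∈-M⁺ (toℕ w) (toℕ<n w))))

  π : Permutation′ n
  π = permutation value position
        (λ w → toℕ-injective (trans (toℕ-fromℕ< _) (trans (cong (nth M) (toℕ-fromℕ< _)) (nth-indexOf M (∈-M⁺ (toℕ w) (toℕ<n w))))))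
        (λ p → toℕ-injective (trans (toℕ-fromℕ< _) (trans (cong (λ v → indexOf v M) (toℕ-fromℕ< _)) (indexOf-nth M (toℕ p) Unique-M (p<length p)))))

  π-value : ∀ p → toℕ (π ⟨$⟩ʳ p) ≡ nth M (toℕ p)
  π-value p = toℕ-fromℕ< _

  π-position : ∀ w → toℕ (π ⟨$⟩ˡ w) ≡ indexOf (toℕ w) M
  π-position w = toℕ-fromℕ< _

  toℕ-Citer-1 : toℕ (Citer π 1) ≡ suc (nth M m)
  toℕ-Citer-1 = trans (cong toℕ (Cπ-top m π)) (cong suc (trans (π-value (fromℕ m)) (cong (nth M) (toℕ-fromℕ m))))

  private
    position-of : ∀ (x : Fin (suc n)) (x<n : toℕ x < n) → toℕ (π ⟨$⟩ˡ fromℕ< x<n) ≡ indexOf (toℕ x) M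
    position-of x x<n = trans (π-position (fromℕ< x<n)) (cong (λ v → indexOf v M) (toℕ-fromℕ< x<n))

  -- C_π x = Y_π (x + 1) is the entry to the left of x + 1, or 0 if x + 1 = a₁.
  Cπ-first : ∀ (x : Fin (suc n)) (x<n : toℕ x < n) → indexOf (toℕ x) M ≡ 0 → Cπ π x ≡ Fin.zero
  Cπ-first x x<n first with π ⟨$⟩ˡ fromℕ< x<n in eq
  ... | Fin.zero  = trans (cong (Yπ π) (Xn-< n x x<n)) (Yπ-first π _ eq)
  ... | Fin.suc q = ⊥-elim (1+n≢0 (trans (sym (cong toℕ eq)) (trans (position-of x x<n) first)))

  Cπ-next : ∀ (x : Fin (suc n)) (x<n : toℕ x < n) p → indexOf (toℕ x) M ≡ suc p → toℕ (Cπ π x) ≡ suc (nth M p)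
  Cπ-next x x<n p next with π ⟨$⟩ˡ fromℕ< x<n in eq
  ... | Fin.zero  = ⊥-elim (1+n≢0 (trans (sym next) (trans (sym (position-of x x<n)) (cong toℕ eq))))
  ... | Fin.suc q = begin
    toℕ (Yπ π (Xn n x))                 ≡⟨ cong (λ y → toℕ (Yπ π y)) (Xn-< n x x<n) ⟩
    toℕ (Yπ π (Fin.suc (fromℕ< x<n)))   ≡⟨ cong toℕ (Yπ-next π _ q eq) ⟩
    suc (toℕ (π ⟨$⟩ʳ inject₁ q))        ≡⟨ cong suc (π-value (inject₁ q)) ⟩
    suc (nth M (toℕ (inject₁ q)))       ≡⟨ cong (λ r → suc (nth M r)) (trans (toℕ-inject₁ q) q≡p) ⟩
    suc (nth M p)                       ∎
    where
    open ≡-Reasoning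
    q≡p : toℕ q ≡ p
    q≡p = suc-injective (trans (cong toℕ (sym eq)) (trans (position-of x x<n) next))

  module Pile (k : ℕ) (k≥1 : 1 ≤ k) (β : ℕ → ℕ)
    (β≥1 : ∀ i → 1 ≤ i → i ≤ k → 1 ≤ β i)
    (β-first : nth M m ≡ β 1 ∸ 1)
    (β-suc : ∀ i → 1 ≤ i → i < k → (β i < n) × Σ ℕ (λ p → (indexOf (β i) M ≡ suc p) × (nth M p ≡ β (suc i) ∸ 1)))
    (β-last : (β k < n) × (indexOf (β k) M ≡ 0)) where

    b≡β : ∀ i → 1 ≤ i → i ≤ k → b π i ≡ β i
    b≡β 1             _ 1≤k   = trans toℕ-Citer-1 (trans (cong suc β-first) (suc-pred≥1 (β≥1 1 (s≤s z≤n) 1≤k)))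
    b≡β (suc (suc i)) _ i+2≤k = step (b≡β (suc i) (s≤s z≤n) (≤-trans (n≤1+n _) i+2≤k)) (β-suc (suc i) (s≤s z≤n) i+2≤k)
      where
      step : b π (suc i) ≡ β (suc i) →
             (β (suc i) < n) × Σ ℕ (λ p → (indexOf (β (suc i)) M ≡ suc p) × (nth M p ≡ β (2 + i) ∸ 1)) →
             b π (2 + i) ≡ β (2 + i)
      step b≡ (βi<n , p , index≡ , nth≡) = begin
        toℕ (Cπ π (Citer π (suc i)))   ≡⟨ Cπ-next (Citer π (suc i)) (subst (_< n) (sym b≡) βi<n) p (trans (cong (λ v → indexOf v M) b≡) index≡) ⟩
        suc (nth M p)                  ≡⟨ cong suc nth≡ ⟩
        suc (β (2 + i) ∸ 1)            ≡⟨ suc-pred≥1 (β≥1 _ (s≤s z≤n) i+2≤k) ⟩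
        β (2 + i)                      ∎
        where open ≡-Reasoning

    pileSize : PileSize π k
    pileSize = Cπ-first (Citer π k) bk<n (trans (cong (λ v → indexOf v M) (b≡β k k≥1 ≤-refl)) (proj₂ β-last)) , nonzero
      where
      bk<n : b π k < n
      bk<n = subst (_< n) (sym (b≡β k k≥1 ≤-refl)) (proj₁ β-last)
      nonzero : ∀ i → 1 ≤ i → i ≤ k → ¬ Citer π i ≡ Fin.zero
      nonzero i 1≤i i≤k ci≡0 = <-irrefl refl (≤-trans (β≥1 i 1≤i i≤k) (≤-reflexive (trans (sym (b≡β i 1≤i i≤k)) (cong toℕ ci≡0))))

iter-+ : ∀ {A : Set} (f : A → A) s d x → iter f (s + d) x ≡ iter f s (iter f d x)
iter-+ f zero    d x = refl
iter-+ f (suc s) d x = cong f (iter-+ f s d x)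

iter-periodic : ∀ {A : Set} (f : A → A) d x → iter f d x ≡ x → ∀ s q → iter f (s + q * d) x ≡ iter f s x
iter-periodic f d x fixed s zero    = cong (λ r → iter f r x) (+-identityʳ s)
iter-periodic f d x fixed s (suc q) = begin
  iter f (s + (d + q * d)) x        ≡⟨ cong (λ r → iter f r x) (sym (+-assoc s d (q * d))) ⟩
  iter f ((s + d) + q * d) x        ≡⟨ iter-periodic f d x fixed (s + d) q ⟩
  iter f (s + d) x                  ≡⟨ iter-+ f s d x ⟩
  iter f s (iter f d x)             ≡⟨ cong (iter f s) fixed ⟩
  iter f s x                        ∎
  where open ≡-Reasoning

AllPairs-++⁻ʳ : ∀ {R : ℕ → ℕ → Set} P {S} → AllPairs R (P ++ S) → AllPairs R S
AllPairs-++⁻ʳ []      sorted     = sorted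
AllPairs-++⁻ʳ (p ∷ P) (_ ∷ rest) = AllPairs-++⁻ʳ P rest

AllPairs-++-∷⇒before : ∀ {R : ℕ → ℕ → Set} P {x S y} → AllPairs R (P ++ x ∷ S) → y ∈ P → R y x
AllPairs-++-∷⇒before (p ∷ P) (p< ∷ _)    (here refl) = All.lookup p< (∈-++⁺ʳ P (here refl))
AllPairs-++-∷⇒before (p ∷ P) (_  ∷ rest) (there y∈) = AllPairs-++-∷⇒before P rest y∈

module _ (f : ℕ → ℕ) where

  sorted-successor : ∀ P x S {j} → AllPairs (λ a c → f a < f c) (P ++ x ∷ S) →
                     j ∈ P ++ x ∷ S → f x + 1 ≡ f j → Σ (List ℕ) (λ S′ → S ≡ j ∷ S′)
  sorted-successor P x S sorted j∈ fj≡ with ∈-++⁻ P j∈ | AllPairs-++⁻ʳ P sorted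
  ... | inj₁ j∈P         | _ = ⊥-elim (<-asym (AllPairs-++-∷⇒before P sorted j∈P) (subst (f x <_) fj≡ (m<m+n _ (s≤s z≤n))))
  ... | inj₂ (here refl) | _ = ⊥-elim (m+1+n≢m (f x) fj≡)
  ... | inj₂ (there (here refl))   | _ = _ , refl
  ... | inj₂ (there (there j∈S′)) | (x<y ∷ x<S′) ∷ (y<S′ ∷ _) =
    ⊥-elim (<-irrefl (trans (+-comm 1 (f x)) fj≡) (≤-<-trans x<y (All.lookup y<S′ j∈S′)))

  sorted-head : ∀ p P {j} → AllPairs (λ a c → f a < f c) (p ∷ P) → j ∈ p ∷ P → f j ≡ 0 → j ≡ p
  sorted-head p P _          (here refl) _    = refl
  sorted-head p P (p< ∷ _) (there j∈P) fj≡0 = ⊥-elim (n≮0 (subst (f p <_) fj≡0 (All.lookup p< j∈P)))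

σstar-++-∷ : ∀ xs P x S → xs ≡ P ++ x ∷ S → x ∉ P → σstar xs x ≡ nth (S ++ [ 1 ]) 0
σstar-++-∷ _ P x []      refl x∉P = trans (cong (λ L → cycleOf L x) (++-assoc P [ x ] [ 1 ])) (cycleOf-++-∷-∷ P x 1 [] x∉P)
σstar-++-∷ _ P x (y ∷ S) refl x∉P = trans (cong (λ L → cycleOf L x) (++-assoc P (x ∷ y ∷ S) [ 1 ])) (cycleOf-++-∷-∷ P x y (S ++ [ 1 ]) x∉P)

≥1∧≢1⇒≥2 : ∀ {j} → 1 ≤ j → ¬ j ≡ 1 → 2 ≤ j
≥1∧≢1⇒≥2 {suc zero}    _ j≢1 = ⊥-elim (j≢1 refl)
≥1∧≢1⇒≥2 {suc (suc j)} _ _   = s≤s (s≤s z≤n)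

module MergeGraph (m : ℕ) (π : Permutation′ (suc m)) (k : ℕ) (k≥1 : 1 ≤ k)
                  (pile : PileSize π k) (xs : List ℕ) (opl : OrderedPairList π k xs) where

  open PairList k k≥1 xs (proj₁ opl)

  n : ℕ
  n = suc m

  c : ℕ → Fin (suc n)
  c = Citer π

  c-nonzero : ∀ i → 1 ≤ i → i ≤ k → ¬ c i ≡ Fin.zero
  c-nonzero = proj₂ pile

  b≥1 : ∀ i → 1 ≤ i → i ≤ k → 1 ≤ b π i
  b≥1 i 1≤i i≤k with nonzero⇒suc (c i) (c-nonzero i 1≤i i≤k)
  ... | w , ci≡ = subst (λ x → 1 ≤ toℕ x) (sym ci≡) (s≤s z≤n)

  posB-1 : posB π 1 ≡ m
  posB-1 = trans (cong (posV π) (Cπ-top m π)) (trans (cong toℕ (inverseˡ π)) (toℕ-fromℕ m))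

  posB≤m : ∀ j → 1 ≤ j → j ≤ k → posB π j ≤ m
  posB≤m j 1≤j j≤k with nonzero⇒suc (c j) (c-nonzero j 1≤j j≤k)
  ... | w , cj≡ = subst (_≤ m) (sym (cong (posV π) cj≡)) (≤-pred (toℕ<n (π ⟨$⟩ˡ w)))

  -- If the orbit of n came back to n after d < k steps it would be periodic and never reach 0.
  c≢top : ∀ d → 1 ≤ d → d < k → ¬ c d ≡ fromℕ n
  c≢top (suc d) _ d<k cd≡top = zero-or-nonzero r (<⇒≤ (<-trans (m%n<n (suc k) (suc d)) d<k)) (trans (sym periodic) (proj₁ pile))
    where
    r = suc k % suc d
    periodic : c (suc k) ≡ c r
    periodic = trans (cong c (m≡m%n+[m/n]*n (suc k) (suc d))) (iter-periodic (Cπ π) (suc d) (fromℕ n) cd≡top r (suc k / suc d))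
    zero-or-nonzero : ∀ r → r ≤ k → ¬ c r ≡ Fin.zero
    zero-or-nonzero zero    _   ()
    zero-or-nonzero (suc r) r≤k = c-nonzero (suc r) (s≤s z≤n) r≤k

  posB≢m : ∀ y → 2 ≤ y → y ≤ k → ¬ posB π y ≡ m
  posB≢m (suc y) (s≤s 1≤y) y<k pos≡m with nonzero⇒suc (c (suc y)) (c-nonzero (suc y) (s≤s z≤n) y<k)
  ... | w , cy≡ = c≢top y 1≤y y<k (toℕ-injective (trans (Xn≡zero⇒top n (c y) X≡0) (sym (toℕ-fromℕ n))))
    where
    π⁻¹w≡ : π ⟨$⟩ˡ w ≡ fromℕ m
    π⁻¹w≡ = toℕ-injective (trans (sym (cong (posV π) cy≡)) (trans pos≡m (sym (toℕ-fromℕ m))))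
    X≡0 : Xn n (c y) ≡ Fin.zero
    X≡0 = Yπ≡a[n]⇒zero m π _ (trans cy≡ (cong Fin.suc (trans (sym (inverseʳ π)) (cong (π ⟨$⟩ʳ_) π⁻¹w≡))))

  c-suc : ∀ i j w → c j ≡ Fin.suc w → b π i + 1 ≡ b π j → c (suc i) ≡ Yπ π (Fin.suc w)
  c-suc i j w cj≡ bi+1≡bj = trans (cong (Yπ π) (Xn-< n (c i) ci<n)) (cong (λ z → Yπ π (Fin.suc z)) (toℕ-injective (trans (toℕ-fromℕ< ci<n) ci≡w)))
    where
    ci≡w : toℕ (c i) ≡ toℕ w
    ci≡w = suc-injective (trans (+-comm 1 _) (trans bi+1≡bj (cong toℕ cj≡)))
    ci<n : toℕ (c i) < n
    ci<n = subst (_< n) (sym ci≡w) (toℕ<n w)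

  merge⇒adjacent : ∀ i j → MergeEdge π k i j →
    ((i < k) × (posB π (suc i) + 1 ≡ posB π j)) ⊎ ((i ≡ k) × (posB π j ≡ 0))
  merge⇒adjacent i j (1≤i , i≤k , 1≤j , j≤k , bi+1≡bj) with nonzero⇒suc (c j) (c-nonzero j 1≤j j≤k)
  ... | w , cj≡ with π ⟨$⟩ˡ w in π⁻¹w
  ...   | Fin.zero  = inj₂ (i≡k , trans (cong (posV π) cj≡) (cong toℕ π⁻¹w))
    where
    i≡k : i ≡ k
    i≡k with suc i ≤? k
    ... | yes i<k = ⊥-elim (c-nonzero (suc i) (s≤s z≤n) i<k (trans (c-suc i j w cj≡ bi+1≡bj) (Yπ-first π w π⁻¹w)))
    ... | no  i≮k = ≤-antisym i≤k (≮⇒≥ i≮k)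
  ...   | Fin.suc q = inj₁ (i<k , trans posB[i+1] (sym (trans (cong (posV π) cj≡) (cong toℕ π⁻¹w))))
    where
    c[i+1]≡entry : c (suc i) ≡ entry π (inject₁ q)
    c[i+1]≡entry = trans (c-suc i j w cj≡ bi+1≡bj) (Yπ-next π w q π⁻¹w)
    i<k : i < k
    i<k with i ≟ k
    ... | no  i≢k  = ≤∧≢⇒< i≤k i≢k
    ... | yes refl = ⊥-elim (0≢1+n (trans (sym (cong toℕ (proj₁ pile))) (cong toℕ c[i+1]≡entry)))
    posB[i+1] : posB π (suc i) + 1 ≡ suc (toℕ q)
    posB[i+1] = trans (cong (λ x → posV π x + 1) c[i+1]≡entry)
                  (trans (cong (λ p → toℕ p + 1) (inverseˡ π)) (trans (cong (_+ 1) (toℕ-inject₁ q)) (+-comm _ 1)))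

  sorted : AllPairs (λ x y → posB π x < posB π y) xs
  sorted = proj₂ opl

  -- b j sits just right of b (suc i), so j follows suc i in the position-sorted list xs, or j = 1
  -- and suc i is last there (b 1 = π n is in the last position).
  τ-adjacent : ∀ i j → 1 ≤ i → i < k → 1 ≤ j → j ≤ k → posB π (suc i) + 1 ≡ posB π j → τ k xs i ≡ j
  τ-adjacent i j 1≤i i<k 1≤j j≤k adjacent with ∈⇒firstSplit xs (∈-xs⁺ (s≤s 1≤i) i<k)
  ... | P , S , xs≡ , i+1∉P =
    trans (cong (σstar xs) (ψ-suc k i 1≤i i<k)) (trans (σstar-++-∷ xs P (suc i) S xs≡ i+1∉P) (successor S xs≡))
    where
    successor : ∀ S → xs ≡ P ++ suc i ∷ S → nth (S ++ [ 1 ]) 0 ≡ j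
    successor S xs≡ with j ≟ 1
    successor []      xs≡ | yes refl = refl
    successor (y ∷ S) xs≡ | yes refl with AllPairs-++⁻ʳ P (subst (AllPairs _) xs≡ sorted)
    ... | (i+1<y ∷ _) ∷ _ = ⊥-elim (posB≢m y 2≤y y≤k (≤-antisym (posB≤m y (≤-trans (s≤s z≤n) 2≤y) y≤k) m≤posB))
      where
      y∈ : y ∈ xs
      y∈ = subst (y ∈_) (sym xs≡) (∈-++⁺ʳ P (there (here refl)))
      2≤y = proj₁ (∈-xs⁻ y∈)
      y≤k = proj₂ (∈-xs⁻ y∈)
      m≤posB : m ≤ posB π y
      m≤posB = subst (_≤ posB π y) (trans adjacent posB-1) (subst (_≤ posB π y) (+-comm 1 _) i+1<y)
    successor S xs≡ | no j≢1
      with sorted-successor (posB π) P (suc i) S (subst (AllPairs _) xs≡ sorted)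
             (subst (j ∈_) xs≡ (∈-xs⁺ (≥1∧≢1⇒≥2 1≤j j≢1) j≤k)) adjacent
    ... | S′ , refl = refl

  -- b j is the first entry of π, so j is first in xs; j = 1 would force n = 1, impossible as
  -- b 1 = b k + 1 ≥ 2.
  τ-wrap : ∀ j → 1 ≤ j → j ≤ k → b π k + 1 ≡ b π j → posB π j ≡ 0 → τ k xs k ≡ j
  τ-wrap j 1≤j j≤k bk+1≡bj pos≡0 =
    trans (cong (σstar xs) (ψ-last k k≥1)) (trans (cycleOf-++-last (xs ++ [ 1 ]) xs 1 refl 1∉xs) (first xs refl))
    where
    first : ∀ L → L ≡ xs → nth (L ++ [ 1 ]) 0 ≡ j
    first L L≡ with j ≟ 1
    ... | yes refl = ⊥-elim (<-irrefl refl (≤-trans (s≤s (b≥1 k k≥1 ≤-refl)) (subst (_≤ 1) (+-comm (b π k) 1) b1≤1)))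
      where
      b1≤1 : b π k + 1 ≤ 1
      b1≤1 = subst (λ v → b π k + 1 ≤ suc v) (trans (sym posB-1) pos≡0) (subst (_≤ n) (sym bk+1≡bj) (≤-pred (toℕ<n (c 1))))
    ... | no j≢1 with subst (j ∈_) (sym L≡) (∈-xs⁺ (≥1∧≢1⇒≥2 1≤j j≢1) j≤k)
    first (p ∷ P) L≡ | no j≢1 | j∈ = sym (sorted-head (posB π) p P (subst (AllPairs _) (sym L≡) sorted) j∈ pos≡0)

  mergeEdge⇒τ : ∀ i j → MergeEdge π k i j → τ k xs i ≡ j
  mergeEdge⇒τ i j edge@(1≤i , i≤k , 1≤j , j≤k , bi+1≡bj) with merge⇒adjacent i j edge
  ... | inj₁ (i<k , adjacent) = τ-adjacent i j 1≤i i<k 1≤j j≤k adjacent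
  ... | inj₂ (refl , pos≡0)   = τ-wrap j 1≤j j≤k bi+1≡bj pos≡0

  mergeEdge⇒tauEdge : ∀ i j → MergeEdge π k i j → TauEdge k xs i j
  mergeEdge⇒tauEdge i j edge@(1≤i , i≤k , _ , _ , bi+1≡bj) =
    1≤i , i≤k , τ≡j , (λ τ≡i → m+1+n≢m (b π i) (trans bi+1≡bj (cong (b π) (trans (sym τ≡j) τ≡i))))
    where
    τ≡j = mergeEdge⇒τ i j edge

Linked-+1⇒< : ∀ (E : ℕ → ℕ → Set) (f : ℕ → ℕ) → (∀ a c → E a c → f a + 1 ≡ f c) →
              ∀ x ys z → Linked E (x ∷ ys ++ [ z ]) → f x < f z
Linked-+1⇒< E f +1 x []       z (e ∷ _)  = ≤-reflexive (trans (+-comm 1 (f x)) (+1 x z e))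
Linked-+1⇒< E f +1 x (y ∷ ys) z (e ∷ es) = <-trans (≤-reflexive (trans (+-comm 1 (f x)) (+1 x y e))) (Linked-+1⇒< E f +1 y ys z es)

mergeGraph-acyclic : ∀ {n} (π : Permutation′ n) k → ¬ HasDirectedCycle (MergeEdge π k)
mergeGraph-acyclic π k (v ∷ vs , _ , linked) =
  <-irrefl refl (Linked-+1⇒< (MergeEdge π k) (b π) (λ _ _ edge → proj₂ (proj₂ (proj₂ (proj₂ edge)))) v vs v linked)

mergeGraph⊆tauGraph : ∀ n (π : Permutation′ n) k → 1 ≤ k → PileSize π k → ∀ xs → OrderedPairList π k xs →
                      ∀ i j → MergeEdge π k i j → TauEdge k xs i j
mergeGraph⊆tauGraph zero    π k k≥1 pile xs opl = ⊥-elim (proj₂ pile 1 (s≤s z≤n) k≥1 (Citer-empty π))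
mergeGraph⊆tauGraph (suc m) π k k≥1 pile xs opl = MergeGraph.mergeEdge⇒tauEdge m π k k≥1 pile xs opl

Edge : Set
Edge = Σ ℕ (λ _ → ℕ)

Linked-++⁻ˡ : ∀ {E : ℕ → ℕ → Set} A x S → Linked E (A ++ x ∷ S) → Linked E (A ++ [ x ])
Linked-++⁻ˡ []          x S _        = [-]
Linked-++⁻ˡ (a ∷ [])    x S (e ∷ _)  = e ∷ [-]
Linked-++⁻ˡ (a ∷ a′ ∷ A) x S (e ∷ es) = e ∷ Linked-++⁻ˡ (a′ ∷ A) x S es

Linked-tail : ∀ {E : ℕ → ℕ → Set} w L → Linked E (w ∷ L) → Linked E L
Linked-tail w []      _        = []
Linked-tail w (x ∷ L) (_ ∷ es) = es

walk-¬Unique⇒cycle : ∀ (E : ℕ → ℕ → Set) L → Linked E L → ¬ Unique L → HasDirectedCycle E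
walk-¬Unique⇒cycle E []      _      ¬unique = ⊥-elim (¬unique [])
walk-¬Unique⇒cycle E (w ∷ L) linked ¬unique with allPairs? (λ x y → ¬? (x ≟ y)) L
... | no ¬uniqueL = walk-¬Unique⇒cycle E L (Linked-tail w L linked) ¬uniqueL
... | yes uniqueL with w ∈? L
...   | no  w∉L = ⊥-elim (¬unique (All.tabulate (λ v∈ w≡v → w∉L (subst (_∈ L) (sym w≡v) v∈)) ∷ uniqueL))
...   | yes w∈L with ∈⇒firstSplit L w∈L
...     | P , S , refl , w∉P =
  w ∷ P ,
  All.tabulate (λ v∈ w≡v → w∉P (subst (_∈ P) (sym w≡v) v∈)) ∷ Unique-++⁻ˡ P (w ∷ S) uniqueL ,
  Linked-++⁻ˡ (w ∷ P) w S linked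

Unique-bounded⇒length≤ : ∀ k L → Unique L → All (λ x → (1 ≤ x) × (x ≤ k)) L → length L ≤ k
Unique-bounded⇒length≤ k L uniqueL bounded with length L ≤? k
... | yes len≤k = len≤k
... | no  len≰k with pigeonhole (≰⇒> len≰k) (λ p → fromℕ< (shifted<k p))
  where
  shifted<k : ∀ (p : Fin (length L)) → nth L (toℕ p) ∸ 1 < k
  shifted<k p = subst (_≤ k) (sym (suc-pred≥1 1≤x)) x≤k
    where
    1≤x = proj₁ (All.lookup bounded (nth∈ L (toℕ p) (toℕ<n p)))
    x≤k = proj₂ (All.lookup bounded (nth∈ L (toℕ p) (toℕ<n p)))
...   | p , q , p<q , same = ⊥-elim (<-irrefl (nth-injective L (toℕ p) (toℕ q) uniqueL (toℕ<n p) (toℕ<n q) nth≡) p<q)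
  where
  1≤nth : ∀ (p : Fin (length L)) → 1 ≤ nth L (toℕ p)
  1≤nth p = proj₁ (All.lookup bounded (nth∈ L (toℕ p) (toℕ<n p)))
  nth≡ : nth L (toℕ p) ≡ nth L (toℕ q)
  nth≡ = trans (sym (suc-pred≥1 (1≤nth p))) (trans (cong suc (trans (sym (toℕ-fromℕ< _)) (trans (cong toℕ same) (toℕ-fromℕ< _)))) (suc-pred≥1 (1≤nth q)))

*+-unique : ∀ K a a′ d d′ .{{_ : NonZero K}} → a * K + d ≡ a′ * K + d′ → d < K → d′ < K → (a ≡ a′) × (d ≡ d′)
*+-unique K a a′ d d′ eq d<K d′<K =
  *-cancelʳ-≡ a a′ K (+-cancelʳ-≡ d (a * K) (a′ * K) (trans eq (cong (a′ * K +_) (sym d≡d′)))) , d≡d′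
  where
  remainder : ∀ q r → r < K → (q * K + r) % K ≡ r
  remainder q r r<K = trans (cong (_% K) (+-comm (q * K) r)) (trans ([m+kn]%n≡m%n r q K) (m<n⇒m%n≡m r<K))
  d≡d′ : d ≡ d′
  d≡d′ = trans (sym (remainder a d d<K)) (trans (cong (_% K) eq) (remainder a′ d′ d′<K))

predecessor : List Edge → ℕ → Maybe ℕ
predecessor []            j = nothing
predecessor ((a , c) ∷ H) j with c ≟ j
... | yes _ = just a
... | no  _ = predecessor H j

predecessor-sound : ∀ H j i → predecessor H j ≡ just i → (i , j) ∈ H
predecessor-sound ((a , c) ∷ H) j i eq with c ≟ j
predecessor-sound ((a , c) ∷ H) j i refl | yes refl = here refl
... | no _ = there (predecessor-sound H j i eq)

predecessor-complete : ∀ H j → predecessor H j ≡ nothing → ∀ i → (i , j) ∉ H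
predecessor-complete ((a , c) ∷ H) j eq i ij∈ with c ≟ j
predecessor-complete ((a , c) ∷ H) j () i ij∈          | yes _
predecessor-complete ((a , c) ∷ H) j eq i (here refl)  | no c≢j = c≢j refl
predecessor-complete ((a , c) ∷ H) j eq i (there ij∈) | no _   = predecessor-complete H j eq i ij∈

module Labelling (k : ℕ) (f : ℕ → ℕ)
  (f-range : ∀ i → 1 ≤ i → i ≤ k → (1 ≤ f i) × (f i ≤ k))
  (f-injective : ∀ i i′ → 1 ≤ i → i ≤ k → 1 ≤ i′ → i′ ≤ k → f i ≡ f i′ → i ≡ i′)
  (H : List Edge)
  (H⊆f : ∀ i j → (i , j) ∈ H → (1 ≤ i) × (i ≤ k) × (f i ≡ j))
  (acyclic : ¬ HasDirectedCycle (λ i j → (i , j) ∈ H)) where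

  depth : ℕ → ℕ → ℕ
  depth zero       j = 0
  depth (suc fuel) j with predecessor H j
  ... | nothing = 0
  ... | just i  = suc (depth fuel i)

  root : ℕ → ℕ → ℕ
  root zero       j = j
  root (suc fuel) j with predecessor H j
  ... | nothing = j
  ... | just i  = root fuel i

  step-just : ∀ fuel j i → predecessor H j ≡ just i → (depth (suc fuel) j ≡ suc (depth fuel i)) × (root (suc fuel) j ≡ root fuel i)
  step-just fuel j i eq with predecessor H j
  step-just fuel j i refl | just .i = refl , refl

  step-nothing : ∀ fuel j → predecessor H j ≡ nothing → depth (suc fuel) j ≡ 0
  step-nothing fuel j eq with predecessor H j
  step-nothing fuel j refl | nothing = refl

  H-target-range : ∀ i j → (i , j) ∈ H → (1 ≤ j) × (j ≤ k)
  H-target-range i j ij∈ with H⊆f i j ij∈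
  ... | 1≤i , i≤k , refl = f-range i 1≤i i≤k

  predecessor-unique : ∀ i i′ j → (i , j) ∈ H → (i′ , j) ∈ H → i ≡ i′
  predecessor-unique i i′ j ij∈ i′j∈ with H⊆f i j ij∈ | H⊆f i′ j i′j∈
  ... | 1≤i , i≤k , fi≡ | 1≤i′ , i′≤k , fi′≡ = f-injective i i′ 1≤i i≤k 1≤i′ i′≤k (trans fi≡ (sym fi′≡))

  depth≤fuel : ∀ fuel j → depth fuel j ≤ fuel
  depth≤fuel zero       j = z≤n
  depth≤fuel (suc fuel) j with predecessor H j
  ... | nothing = z≤n
  ... | just i  = s≤s (depth≤fuel fuel i)

  root-range : ∀ fuel j → 1 ≤ j → j ≤ k → (1 ≤ root fuel j) × (root fuel j ≤ k)
  root-range zero       j 1≤j j≤k = 1≤j , j≤k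
  root-range (suc fuel) j 1≤j j≤k with predecessor H j in eq
  ... | nothing = 1≤j , j≤k
  ... | just i with H⊆f i j (predecessor-sound H j i eq)
  ...   | 1≤i , i≤k , _ = root-range fuel i 1≤i i≤k

  iter-root : ∀ fuel j → iter f (depth fuel j) (root fuel j) ≡ j
  iter-root zero       j = refl
  iter-root (suc fuel) j with predecessor H j in eq
  ... | nothing = refl
  ... | just i with H⊆f i j (predecessor-sound H j i eq)
  ...   | _ , _ , fi≡j = trans (cong f (iter-root fuel i)) fi≡j

  path-edges : ∀ fuel j s → s < depth fuel j → (iter f s (root fuel j) , iter f (suc s) (root fuel j)) ∈ H
  path-edges (suc fuel) j s s< with predecessor H j in eq
  ... | just i with s ≟ depth fuel i
  ...   | yes refl = subst₂ (λ a c → (a , c) ∈ H) (sym (iter-root fuel i))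
                       (sym (trans (cong f (iter-root fuel i)) (proj₂ (proj₂ (H⊆f i j ij∈))))) ij∈
    where
    ij∈ = predecessor-sound H j i eq
  ...   | no  s≢ = path-edges fuel i s (≤∧≢⇒< (≤-pred s<) s≢)

  depth-stable : ∀ fuel fuel′ j → depth fuel j < fuel → fuel ≤ fuel′ → (depth fuel′ j ≡ depth fuel j) × (root fuel′ j ≡ root fuel j)
  depth-stable (suc fuel) (suc fuel′) j d< (s≤s fuel≤) with predecessor H j
  ... | nothing = refl , refl
  ... | just i with depth-stable fuel fuel′ i (≤-pred d<) fuel≤
  ...   | d≡ , r≡ = cong suc d≡ , r≡

  iter-range : ∀ s x → 1 ≤ x → x ≤ k → (1 ≤ iter f s x) × (iter f s x ≤ k)
  iter-range zero    x 1≤x x≤k = 1≤x , x≤k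
  iter-range (suc s) x 1≤x x≤k with iter-range s x 1≤x x≤k
  ... | 1≤y , y≤k = f-range (iter f s x) 1≤y y≤k

  -- A path of more than k edges would repeat a vertex of [1, k] and so contain a cycle.
  depth≤k : ∀ fuel j → 1 ≤ j → j ≤ k → depth fuel j ≤ k
  depth≤k fuel j 1≤j j≤k with depth fuel j ≤? k
  ... | yes d≤k = d≤k
  ... | no  d≰k = ⊥-elim (acyclic (walk-¬Unique⇒cycle (λ a c → (a , c) ∈ H) walk linked ¬unique))
    where
    r = root fuel j
    walk : List ℕ
    walk = applyUpTo (λ s → iter f s r) (suc k)
    linked : Linked (λ a c → (a , c) ∈ H) walk
    linked = LinkedP.applyUpTo⁺₁ {R = λ a c → (a , c) ∈ H} (λ s → iter f s r) (suc k)
               (λ {s} s+1< → path-edges fuel j s (<-≤-trans (≤-pred s+1<) (<⇒≤ (≰⇒> d≰k))))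
    ¬unique : ¬ Unique walk
    ¬unique unique = 1+n≰n (subst (_≤ k) (length-applyUpTo (λ s → iter f s r) (suc k))
      (Unique-bounded⇒length≤ k walk unique (AllP.applyUpTo⁺₁ {P = λ x → (1 ≤ x) × (x ≤ k)} (λ s → iter f s r) (suc k) (λ {s} _ → iter-range s r (proj₁ (root-range fuel j 1≤j j≤k)) (proj₂ (root-range fuel j 1≤j j≤k))))))

  K : ℕ
  K = suc (suc (suc k))

  label : ℕ → ℕ
  label j = suc (root (suc k) j) * K + depth (suc k) j

  depth<K : ∀ j → depth (suc k) j < K
  depth<K j = ≤-trans (s≤s (depth≤fuel (suc k) j)) (n≤1+n _)

  label-injective : ∀ j j′ → label j ≡ label j′ → j ≡ j′
  label-injective j j′ eq with *+-unique K (suc (root (suc k) j)) (suc (root (suc k) j′)) _ _ eq (depth<K j) (depth<K j′)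
  ... | r≡ , d≡ = trans (sym (iter-root (suc k) j)) (trans (cong₂ (iter f) d≡ (suc-injective r≡)) (iter-root (suc k) j′))

  label≥1 : ∀ j → 1 ≤ label j
  label≥1 j = ≤-trans (s≤s z≤n) (m≤m+n (K + root (suc k) j * K) (depth (suc k) j))

  N : ℕ
  N = suc (suc k) * K

  label<N : ∀ j → 1 ≤ j → j ≤ k → label j < N
  label<N j 1≤j j≤k = begin-strict
    suc (root (suc k) j) * K + depth (suc k) j   ≤⟨ +-monoˡ-≤ _ (*-monoˡ-≤ K (s≤s (proj₂ (root-range (suc k) j 1≤j j≤k)))) ⟩
    suc k * K + depth (suc k) j                  <⟨ +-monoʳ-< (suc k * K) (depth<K j) ⟩
    suc k * K + K                                ≡⟨ +-comm (suc k * K) K ⟩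
    N                                            ∎
    where open ≤-Reasoning

  through-predecessor : ∀ i j → (i , j) ∈ H → predecessor H j ≡ just i →
                        (depth (suc k) j ≡ suc (depth (suc k) i)) × (root (suc k) j ≡ root (suc k) i)
  through-predecessor i j ij∈ eq with step-just k j i eq
  ... | d≡ , r≡ with depth-stable k (suc k) i (subst (_≤ k) d≡ (depth≤k (suc k) j (proj₁ range) (proj₂ range))) (n≤1+n k)
    where range = H-target-range i j ij∈
  ...   | d′≡ , r′≡ = trans d≡ (cong suc (sym d′≡)) , trans r≡ (sym r′≡)

  predecessor-cases : ∀ j → (predecessor H j ≡ nothing) ⊎ Σ ℕ (λ p → predecessor H j ≡ just p)
  predecessor-cases j with predecessor H j
  ... | nothing = inj₁ refl
  ... | just p  = inj₂ (p , refl)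

  edge⇒predecessor : ∀ i j → (i , j) ∈ H → predecessor H j ≡ just i
  edge⇒predecessor i j ij∈ with predecessor H j in eq
  ... | nothing = ⊥-elim (predecessor-complete H j eq i ij∈)
  ... | just p  = cong just (predecessor-unique p i j (predecessor-sound H j p eq) ij∈)

  edge⇒label+1 : ∀ i j → (i , j) ∈ H → label i + 1 ≡ label j
  edge⇒label+1 i j ij∈ = begin
    suc (root (suc k) i) * K + depth (suc k) i + 1        ≡⟨ +-assoc (suc (root (suc k) i) * K) _ 1 ⟩
    suc (root (suc k) i) * K + (depth (suc k) i + 1)      ≡⟨ cong₂ (λ r d → suc r * K + d) (sym r≡) (trans (+-comm _ 1) (sym d≡)) ⟩
    suc (root (suc k) j) * K + depth (suc k) j            ∎
    where
    open ≡-Reasoning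
    d≡ = proj₁ (through-predecessor i j ij∈ (edge⇒predecessor i j ij∈))
    r≡ = proj₂ (through-predecessor i j ij∈ (edge⇒predecessor i j ij∈))

  label+1⇒edge : ∀ i j → label i + 1 ≡ label j → (i , j) ∈ H
  label+1⇒edge i j eq with *+-unique K (suc (root (suc k) i)) (suc (root (suc k) j)) (depth (suc k) i + 1) (depth (suc k) j)
                               (trans (sym (+-assoc (suc (root (suc k) i) * K) _ 1)) eq)
                               (s≤s (subst (_≤ suc (suc k)) (+-comm 1 _) (s≤s (depth≤fuel (suc k) i)))) (depth<K j)
  ... | r≡ , d≡ with predecessor-cases j
  ...   | inj₁ pj       = ⊥-elim (1+n≢0 (trans (+-comm 1 _) (trans d≡ (step-nothing k j pj))))
  ...   | inj₂ (p , pj) = subst (λ z → (z , j) ∈ H) (label-injective p i label≡) pj∈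
    where
    pj∈ = predecessor-sound H j p pj
    label≡ : label p ≡ label i
    label≡ with through-predecessor p j pj∈ pj
    ... | dj≡ , rj≡ = cong₂ (λ r d → suc r * K + d)
                        (trans (sym rj≡) (sym (suc-injective r≡)))
                        (suc-injective (trans (sym dj≡) (trans (sym d≡) (+-comm _ 1))))

concatMap-++ : ∀ (g : ℕ → List ℕ) A B → concatMap g (A ++ B) ≡ concatMap g A ++ concatMap g B
concatMap-++ g A B = trans (cong concat (map-++ g A B)) (sym (concat-++ (map g A) (map g B)))

∈-concatMap-intro : ∀ (g : ℕ → List ℕ) ts t {v} → t ∈ ts → v ∈ g t → v ∈ concatMap g ts
∈-concatMap-intro g ts t t∈ v∈ = ∈-concatMap⁺ g (lose t∈ v∈)

∈-concatMap-elim : ∀ (g : ℕ → List ℕ) ts {v} → v ∈ concatMap g ts → Σ ℕ (λ t → (t ∈ ts) × (v ∈ g t))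
∈-concatMap-elim g ts v∈ = find (∈-concatMap⁻ g v∈)

Unique-concatMap : ∀ (g : ℕ → List ℕ) ts → (∀ t → t ∈ ts → Unique (g t)) →
                   AllPairs (λ a c → ∀ {v} → v ∈ g a → v ∉ g c) ts → Unique (concatMap g ts)
Unique-concatMap g []       _      _                = []
Unique-concatMap g (t ∷ ts) unique (disjoint ∷ rest) =
  Unique.++⁺ (unique t (here refl)) (Unique-concatMap g ts (λ s s∈ → unique s (there s∈)) rest)
    (λ (v∈t , v∈ts) → let (s , s∈ , v∈s) = ∈-concatMap-elim g ts v∈ts in All.lookup disjoint s∈ v∈t v∈s)

upTo-split : ∀ t d → upTo (t + suc d) ≡ upTo t ++ t ∷ applyUpTo (λ z → t + suc z) d
upTo-split t d = go (λ z → z) t d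
  where
  go : ∀ (f : ℕ → ℕ) t d → applyUpTo f (t + suc d) ≡ applyUpTo f t ++ f t ∷ applyUpTo (λ z → f (t + suc z)) d
  go f zero    d = refl
  go f (suc t) d = cong (f 0 ∷_) (go (λ z → f (suc z)) t d)

iter-+1 : ∀ (R : ℕ → Set) (f g : ℕ → ℕ) → (∀ y → R y → R (f y)) → (∀ y → R y → g (f y) ≡ g y + 1) →
          ∀ s x → R x → (R (iter f s x)) × (g (iter f s x) ≡ g x + s)
iter-+1 R f g R-step g-step zero    x Rx = Rx , sym (+-identityʳ (g x))
iter-+1 R f g R-step g-step (suc s) x Rx with iter-+1 R f g R-step g-step s x Rx
... | Ry , gy≡ = R-step _ Ry , trans (g-step _ Ry) (trans (cong (_+ 1) gy≡) (trans (+-assoc (g x) s 1) (cong (g x +_) (+-comm s 1))))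

TauEdge⇒graph : ∀ {k xs i j} → TauEdge k xs i j → (1 ≤ i) × (i ≤ k) × (τ k xs i ≡ j)
TauEdge⇒graph (1≤i , i≤k , τi≡j , _) = 1≤i , i≤k , τi≡j

-- The permutation realising H lists the values label j ∸ 1 in k blocks, block t running from
-- label (u t ∸ 1) to label (u (suc t)) ∸ 1.  Consecutive blocks t, t + 1 meet at the pair
-- label (i + 1) ∸ 1, label i where i + 1 = u (t + 1), which makes C_π (label i) = label (i + 1).
-- A block collapses to one value exactly when its two ends come from an edge of H, and the
-- values not of this form are parked inside some block that does not collapse.
module Construction (k₀ : ℕ) (xs : List ℕ) (xs↭ : xs ↭ from2to (suc k₀)) (H : List Edge)
  (H⊆τ : ∀ i j → (i , j) ∈ H → TauEdge (suc k₀) xs i j)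
  (acyclic : ¬ HasDirectedCycle (λ i j → (i , j) ∈ H)) where

  k : ℕ
  k = suc k₀

  open PairList k (s≤s z≤n) xs xs↭
  open Labelling k (τ k xs) τ-range τ-injective H (λ i j ij∈ → TauEdge⇒graph {xs = xs} (H⊆τ i j ij∈)) acyclic

  start : ℕ → ℕ
  start t = label (u t ∸ 1)

  end : ℕ → ℕ
  end t = label (u (suc t)) ∸ 1

  start-injective : ∀ a c → a < k → c < k → start a ≡ start c → a ≡ c
  start-injective a c a<k c<k eq =
    u-injective a c (<⇒≤ a<k) (<⇒≤ c<k) (trans (sym (suc-pred≥1 (1≤u a (<⇒≤ a<k)))) (trans (cong suc (label-injective _ _ eq)) (suc-pred≥1 (1≤u c (<⇒≤ c<k)))))

  end-injective : ∀ a c → a < k → c < k → end a ≡ end c → a ≡ c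
  end-injective a c a<k c<k eq =
    suc-injective (u-injective (suc a) (suc c) a<k c<k (label-injective _ _ (trans (sym (suc-pred≥1 (label≥1 _))) (trans (cong suc eq) (suc-pred≥1 (label≥1 _))))))

  start≡end⇒edge : ∀ a c → a < k → c < k → start a ≡ end c → (u a ∸ 1 , u (suc c)) ∈ H
  start≡end⇒edge a c a<k c<k eq =
    label+1⇒edge _ _ (trans (+-comm _ 1) (trans (cong suc eq) (suc-pred≥1 (label≥1 _))))

  start≡end⇒≡ : ∀ a c → a < k → c < k → start a ≡ end c → a ≡ c
  start≡end⇒≡ a c a<k c<k eq = suc-injective (u-injective (suc a) (suc c) a<k c<k
    (trans (sym (τ-u a a<k)) (proj₂ (proj₂ (TauEdge⇒graph {xs = xs} (H⊆τ _ _ (start≡end⇒edge a c a<k c<k eq)))))))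

  endpoints : ℕ → List ℕ
  endpoints t = start t ∷ end t ∷ []

  ends : List ℕ
  ends = concatMap endpoints (upTo k)

  start∈ends : ∀ t → t < k → start t ∈ ends
  start∈ends t t<k = ∈-concatMap-intro endpoints (upTo k) t (∈-upTo⁺ t<k) (here refl)

  end∈ends : ∀ t → t < k → end t ∈ ends
  end∈ends t t<k = ∈-concatMap-intro endpoints (upTo k) t (∈-upTo⁺ t<k) (there (here refl))

  filler : List ℕ
  filler = filter (λ v → ¬? (v ∈? ends)) (upTo N)

  filler∉ends : ∀ {v} → v ∈ filler → v ∉ ends
  filler∉ends v∈ = proj₂ (∈-filter⁻ (λ v → ¬? (v ∈? ends)) {xs = upTo N} v∈)

  Unique-filler : Unique filler
  Unique-filler = Unique.filter⁺ (λ v → ¬? (v ∈? ends)) (upTo⁺ N)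

  -- If every block collapsed, label ∘ τ = label + 1 on [1, k] would make labels grow beyond N.
  some-block-open : Σ ℕ (λ t → (t < k) × ¬ start t ≡ end t)
  some-block-open = decidable-stable (anyUpTo? (λ t → ¬? (start t ≟ end t)) k) not-all-collapsed
    where
    not-all-collapsed : ¬ ¬ Σ ℕ (λ t → (t < k) × ¬ start t ≡ end t)
    not-all-collapsed ¬open = <-irrefl refl (<-≤-trans (label<N _ (proj₁ in-range) (proj₂ in-range)) (≤-trans (m≤n+m N (label k)) (≤-reflexive (sym grows))))
      where
      collapsed : ∀ t → t < k → start t ≡ end t
      collapsed t t<k = decidable-stable (start t ≟ end t) (λ ne → ¬open (t , t<k , ne))
      InRange : ℕ → Set
      InRange i = (1 ≤ i) × (i ≤ k)
      label-step : ∀ i → InRange i → label (τ k xs i) ≡ label i + 1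
      label-step i (1≤i , i≤k) with u-covers i 1≤i i≤k
      ... | t , t<k , ut≡ = begin
        label (τ k xs i)             ≡⟨ cong label (τ-at i t ut≡ t<k) ⟩
        label (u (suc t))            ≡⟨ sym (suc-pred≥1 (label≥1 _)) ⟩
        suc (end t)                  ≡⟨ cong suc (sym (collapsed t t<k)) ⟩
        suc (label (u t ∸ 1))        ≡⟨ cong (λ v → suc (label (v ∸ 1))) ut≡ ⟩
        suc (label i)                ≡⟨ +-comm 1 _ ⟩
        label i + 1                  ∎
        where open ≡-Reasoning
      walk = iter-+1 InRange (τ k xs) label (λ i (1≤i , i≤k) → τ-range i 1≤i i≤k) label-step N k (s≤s z≤n , ≤-refl)
      in-range = proj₁ walk
      grows = proj₂ walk

  opaque
    t₀ : ℕ
    t₀ = proj₁ some-block-open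

    t₀<k : t₀ < k
    t₀<k = proj₁ (proj₂ some-block-open)

    t₀-open : ¬ start t₀ ≡ end t₀
    t₀-open = proj₂ (proj₂ some-block-open)

  interior : ∀ t → Dec (t ≡ t₀) → List ℕ
  interior t (yes _) = filler
  interior t (no  _) = []

  blockOf : ∀ t → Dec (start t ≡ end t) → Dec (t ≡ t₀) → List ℕ
  blockOf t (yes _) _   = [ start t ]
  blockOf t (no  _) t≟ = start t ∷ interior t t≟ ++ [ end t ]

  block : ℕ → List ℕ
  block t = blockOf t (start t ≟ end t) (t ≟ t₀)

  block-head : ∀ t → Σ (List ℕ) (λ Y → block t ≡ start t ∷ Y)
  block-head t = go (start t ≟ end t) (t ≟ t₀)
    where
    go : ∀ d t≟ → Σ (List ℕ) (λ Y → blockOf t d t≟ ≡ start t ∷ Y)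
    go (yes _) _ = [] , refl
    go (no  _) _ = _ , refl

  block-last : ∀ t → Σ (List ℕ) (λ X → block t ≡ X ++ [ end t ])
  block-last t = go (start t ≟ end t) (t ≟ t₀)
    where
    go : ∀ d t≟ → Σ (List ℕ) (λ X → blockOf t d t≟ ≡ X ++ [ end t ])
    go (yes eq) _   = [] , cong [_] eq
    go (no  _)  t≟ = start t ∷ interior t t≟ , refl

  start∈block : ∀ t → start t ∈ block t
  start∈block t = subst (start t ∈_) (sym (proj₂ (block-head t))) (here refl)

  end∈block : ∀ t → end t ∈ block t
  end∈block t = subst (end t ∈_) (sym (proj₂ (block-last t))) (∈-++⁺ʳ _ (here refl))

  filler⊆block : ∀ {v} → v ∈ filler → v ∈ block t₀
  filler⊆block {v} v∈ = go (start t₀ ≟ end t₀) (t₀ ≟ t₀)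
    where
    go : ∀ d t≟ → v ∈ blockOf t₀ d t≟
    go (yes eq) _          = ⊥-elim (t₀-open eq)
    go (no  _)  (yes _)    = there (∈-++⁺ˡ v∈)
    go (no  _)  (no t₀≢t₀) = ⊥-elim (t₀≢t₀ refl)

  BlockMember : ℕ → ℕ → Set
  BlockMember t v = (v ≡ start t) ⊎ (v ≡ end t) ⊎ ((t ≡ t₀) × (v ∈ filler))

  block-mem : ∀ t {v} → v ∈ block t → BlockMember t v
  block-mem t = go (start t ≟ end t) (t ≟ t₀)
    where
    fillerOrEnd : ∀ {v} → t ≡ t₀ → (v ∈ filler) ⊎ (v ∈ [ end t ]) → BlockMember t v
    fillerOrEnd t≡t₀ (inj₁ v∈filler)  = inj₂ (inj₂ (t≡t₀ , v∈filler))
    fillerOrEnd t≡t₀ (inj₂ (here eq)) = inj₂ (inj₁ eq)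

    go : ∀ d t≟ {v} → v ∈ blockOf t d t≟ → BlockMember t v
    go (yes _) _          (here eq)          = inj₁ eq
    go (no  _) _          (here eq)          = inj₁ eq
    go (no  _) (yes t≡t₀) (there v∈)         = fillerOrEnd t≡t₀ (∈-++⁻ filler v∈)
    go (no  _) (no  _)    (there (here eq))  = inj₂ (inj₁ eq)

  Unique-block : ∀ t → t < k → Unique (block t)
  Unique-block t t<k = go (start t ≟ end t) (t ≟ t₀)
    where
    go : ∀ d t≟ → Unique (blockOf t d t≟)
    go (yes _)  _       = [] ∷ []
    go (no  ne) (yes _) = All.tabulate (λ v∈ eq → start∉ (subst (_∈ filler ++ [ end t ]) (sym eq) v∈)) ∷
                          Unique.++⁺ Unique-filler ([] ∷ []) (λ { (v∈ , here refl) → filler∉ends v∈ (end∈ends t t<k) })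
      where
      start∉ : start t ∉ filler ++ [ end t ]
      start∉ s∈ = fillerOrEnd (∈-++⁻ filler s∈)
        where
        fillerOrEnd : (start t ∈ filler) ⊎ (start t ∈ [ end t ]) → ⊥
        fillerOrEnd (inj₁ s∈filler)  = filler∉ends s∈filler (start∈ends t t<k)
        fillerOrEnd (inj₂ (here eq)) = ne eq
    go (no  ne) (no  _) = (ne ∷ []) ∷ ([] ∷ [])

  block-disjoint : ∀ a c → a < k → c < k → ¬ a ≡ c → ∀ {v} → v ∈ block a → v ∉ block c
  block-disjoint a c a<k c<k a≢c v∈a v∈c = cases (block-mem a v∈a) (block-mem c v∈c)
    where
    cases : ∀ {v} → BlockMember a v → BlockMember c v → ⊥
    cases (inj₁ eq₁)               (inj₁ eq₂)               = a≢c (start-injective a c a<k c<k (trans (sym eq₁) eq₂))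
    cases (inj₁ eq₁)               (inj₂ (inj₁ eq₂))        = a≢c (start≡end⇒≡ a c a<k c<k (trans (sym eq₁) eq₂))
    cases (inj₂ (inj₁ eq₁))        (inj₁ eq₂)               = a≢c (sym (start≡end⇒≡ c a c<k a<k (trans (sym eq₂) eq₁)))
    cases (inj₂ (inj₁ eq₁))        (inj₂ (inj₁ eq₂))        = a≢c (end-injective a c a<k c<k (trans (sym eq₁) eq₂))
    cases (inj₂ (inj₂ (_ , v∈F)))  (inj₁ eq₂)               = filler∉ends v∈F (subst (_∈ ends) (sym eq₂) (start∈ends c c<k))
    cases (inj₂ (inj₂ (_ , v∈F)))  (inj₂ (inj₁ eq₂))        = filler∉ends v∈F (subst (_∈ ends) (sym eq₂) (end∈ends c c<k))
    cases (inj₁ eq₁)               (inj₂ (inj₂ (_ , v∈F)))  = filler∉ends v∈F (subst (_∈ ends) (sym eq₁) (start∈ends a a<k))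
    cases (inj₂ (inj₁ eq₁))        (inj₂ (inj₂ (_ , v∈F)))  = filler∉ends v∈F (subst (_∈ ends) (sym eq₁) (end∈ends a a<k))
    cases (inj₂ (inj₂ (a≡t₀ , _))) (inj₂ (inj₂ (c≡t₀ , _))) = a≢c (trans a≡t₀ (sym c≡t₀))

  M : List ℕ
  M = concatMap block (upTo k)

  Unique-M : Unique M
  Unique-M = Unique-concatMap block (upTo k) (λ t t∈ → Unique-block t (∈-upTo⁻ t∈))
    (AllPairsP.applyUpTo⁺₁ (λ t → t) k (λ {i} {j} i<j j<k → block-disjoint i j (<-trans i<j j<k) j<k (<⇒≢ i<j)))

  ∈-M⁺ : ∀ v → v < N → v ∈ M
  ∈-M⁺ v v<N = from (v ∈? ends)
    where
    inEndpoints : ∀ t → v ∈ endpoints t → v ∈ block t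
    inEndpoints t (here refl)         = start∈block t
    inEndpoints t (there (here refl)) = end∈block t
    from : Dec (v ∈ ends) → v ∈ M
    from (yes v∈) = let (t , t∈ , v∈t) = ∈-concatMap-elim endpoints (upTo k) v∈ in
                    ∈-concatMap-intro block (upTo k) t t∈ (inEndpoints t v∈t)
    from (no  v∉) = ∈-concatMap-intro block (upTo k) t₀ (∈-upTo⁺ t₀<k)
                      (filler⊆block (∈-filter⁺ (λ v → ¬? (v ∈? ends)) (∈-upTo⁺ v<N) v∉))

  ∈-M⁻ : ∀ v → v ∈ M → v < N
  ∈-M⁻ v v∈ = let (t , t∈ , v∈t) = ∈-concatMap-elim block (upTo k) v∈ in bound t (∈-upTo⁻ t∈) (block-mem t v∈t)
    where
    bound : ∀ t → t < k → BlockMember t v → v < N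
    bound t t<k (inj₁ refl)              = label<N _ (proj₁ (u-pred-range t t<k)) (proj₂ (u-pred-range t t<k))
    bound t t<k (inj₂ (inj₁ refl))       = ≤-<-trans (m∸n≤m _ 1) (label<N _ (proj₁ (u-suc-range t t<k)) (proj₂ (u-suc-range t t<k)))
    bound t t<k (inj₂ (inj₂ (_ , v∈F))) = ∈-upTo⁻ (proj₁ (∈-filter⁻ (λ v → ¬? (v ∈? ends)) v∈F))

  M-upTo-suc : ∀ t → concatMap block (upTo (suc t)) ≡ concatMap block (upTo t) ++ block t
  M-upTo-suc t = trans (cong (concatMap block) (sym (upTo-∷ʳ t)))
                   (trans (concatMap-++ block (upTo t) [ t ]) (cong (concatMap block (upTo t) ++_) (++-identityʳ (block t))))

  M-around : ∀ t → t < k → M ≡ concatMap block (upTo t) ++ block t ++ concatMap block (applyUpTo (λ z → t + suc z) (k ∸ suc t))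
  M-around t t<k = trans (cong (λ n → concatMap block (upTo n)) k≡)
                     (trans (cong (concatMap block) (upTo-split t (k ∸ suc t))) (concatMap-++ block (upTo t) _))
    where
    k≡ : k ≡ t + suc (k ∸ suc t)
    k≡ = sym (trans (+-suc t (k ∸ suc t)) (m+[n∸m]≡n t<k))

  M-head : Σ (List ℕ) (λ Y → M ≡ start 0 ∷ Y)
  M-head = proj₁ (block-head 0) ++ concatMap block (applyUpTo suc k₀) ,
           cong (_++ concatMap block (applyUpTo suc k₀)) (proj₂ (block-head 0))

  M-last : Σ (List ℕ) (λ P → M ≡ P ++ [ end k₀ ])
  M-last = concatMap block (upTo k₀) ++ X , (begin
    M                                          ≡⟨ M-upTo-suc k₀ ⟩
    concatMap block (upTo k₀) ++ block k₀      ≡⟨ cong (concatMap block (upTo k₀) ++_) (proj₂ (block-last k₀)) ⟩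
    concatMap block (upTo k₀) ++ X ++ [ end k₀ ] ≡⟨ sym (++-assoc (concatMap block (upTo k₀)) X [ end k₀ ]) ⟩
    (concatMap block (upTo k₀) ++ X) ++ [ end k₀ ] ∎)
    where
    open ≡-Reasoning
    X = proj₁ (block-last k₀)

  M-boundary : ∀ t → suc t < k → Σ (List ℕ) (λ P → Σ (List ℕ) (λ S → M ≡ P ++ end t ∷ start (suc t) ∷ S))
  M-boundary t t+1<k = A ++ X , Y ++ R , (begin
    M                                              ≡⟨ M-around (suc t) t+1<k ⟩
    concatMap block (upTo (suc t)) ++ block (suc t) ++ R
                                                   ≡⟨ cong₂ (λ L L′ → L ++ L′ ++ R) (M-upTo-suc t) (proj₂ (block-head (suc t))) ⟩
    (A ++ block t) ++ (start (suc t) ∷ Y) ++ R     ≡⟨ cong (λ L → (A ++ L) ++ (start (suc t) ∷ Y) ++ R) (proj₂ (block-last t)) ⟩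
    (A ++ X ++ [ end t ]) ++ start (suc t) ∷ Y ++ R ≡⟨ cong (_++ start (suc t) ∷ Y ++ R) (sym (++-assoc A X [ end t ])) ⟩
    ((A ++ X) ++ [ end t ]) ++ start (suc t) ∷ Y ++ R ≡⟨ ++-assoc (A ++ X) [ end t ] _ ⟩
    (A ++ X) ++ end t ∷ start (suc t) ∷ Y ++ R     ∎)
    where
    open ≡-Reasoning
    A = concatMap block (upTo t)
    X = proj₁ (block-last t)
    Y = proj₁ (block-head (suc t))
    R = concatMap block (applyUpTo (λ z → suc t + suc z) (k ∸ suc (suc t)))

  M-order : ∀ s s′ → s < s′ → s′ < k → ∀ {v w} → v ∈ block s → w ∈ block s′ → indexOf v M < indexOf w M
  M-order s s′ s<s′ s′<k v∈ w∈ =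
    subst (λ L → indexOf _ L < indexOf _ L) (sym (M-around s′ s′<k))
      (indexOf-++-< (concatMap block (upTo s′)) _ (subst Unique (M-around s′ s′<k) Unique-M)
        (∈-concatMap-intro block (upTo s′) s (∈-upTo⁺ s<s′) v∈) (∈-++⁺ˡ w∈))

  M-adjacent : ∀ P a c S → M ≡ P ++ a ∷ c ∷ S → (indexOf c M ≡ suc (length P)) × (nth M (length P) ≡ a)
  M-adjacent P a c S M≡ = index≡ , trans (cong (λ L → nth L (length P)) M≡) (nth-++-∷ P a (c ∷ S))
    where
    M≡′ : M ≡ (P ++ [ a ]) ++ c ∷ S
    M≡′ = trans M≡ (sym (++-assoc P [ a ] (c ∷ S)))
    index≡ : indexOf c M ≡ suc (length P)
    index≡ = begin
      indexOf c M                             ≡⟨ cong (indexOf c) M≡′ ⟩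
      indexOf c ((P ++ [ a ]) ++ c ∷ S)       ≡⟨ indexOf-++-∷ (P ++ [ a ]) S (Unique-++-∷⇒∉ (P ++ [ a ]) c S (subst Unique M≡′ Unique-M)) ⟩
      length (P ++ [ a ])                     ≡⟨ trans (length-++ P) (+-comm (length P) 1) ⟩
      suc (length P)                          ∎
      where open ≡-Reasoning

  m : ℕ
  m = suc (suc k) + suc k * K

  open OneLine m M Unique-M ∈-M⁺ ∈-M⁻ public

  β-first : nth M m ≡ label 1 ∸ 1
  β-first = trans (cong (nth M) m≡) (trans (cong (λ L → nth L (length P)) M≡) (trans (nth-++-∷ P (end k₀) []) (cong (λ v → label v ∸ 1) u-last)))
    where
    P = proj₁ M-last
    M≡ = proj₂ M-last
    m≡ : m ≡ length P
    m≡ = suc-injective (trans (sym length-M) (trans (cong length M≡) (trans (length-++ P) (+-comm (length P) 1))))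

  β-suc : ∀ i → 1 ≤ i → i < k → (label i < N) × Σ ℕ (λ p → (indexOf (label i) M ≡ suc p) × (nth M p ≡ label (suc i) ∸ 1))
  β-suc i 1≤i i<k = label<N i 1≤i (<⇒≤ i<k) , boundary (u-covers i 1≤i (<⇒≤ i<k))
    where
    boundary : Σ ℕ (λ t → (t < k) × (u t ≡ suc i)) → Σ ℕ (λ p → (indexOf (label i) M ≡ suc p) × (nth M p ≡ label (suc i) ∸ 1))
    boundary (zero  , _     , u0≡) = ⊥-elim (<-irrefl (sym (suc-injective u0≡)) i<k)
    boundary (suc t , t+1<k , ut≡) =
      let (P , S , M≡) = M-boundary t t+1<k
          (index≡ , nth≡) = M-adjacent P _ _ S M≡
      in length P , trans (cong (λ v → indexOf (label (v ∸ 1)) M) (sym ut≡)) index≡ , trans nth≡ (cong (λ v → label v ∸ 1) ut≡)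

  β-last : (label k < N) × (indexOf (label k) M ≡ 0)
  β-last = label<N k (s≤s z≤n) ≤-refl , trans (cong (indexOf (label k)) (proj₂ M-head)) (indexOf-head _ _)

  open Pile k (s≤s z≤n) label (λ i _ _ → label≥1 i) β-first β-suc β-last public

  posB≡ : ∀ j → 1 ≤ j → j ≤ k → posB π j ≡ indexOf (label j ∸ 1) M
  posB≡ j 1≤j j≤k =
    let (w , cj≡) = nonzero⇒suc (Citer π j) (proj₂ pileSize j 1≤j j≤k) in
    trans (cong (posV π) cj≡) (trans (π-position w) (cong (λ v → indexOf (v ∸ 1) M) (trans (sym (cong toℕ cj≡)) (b≡β j 1≤j j≤k))))

  orderedPairList : OrderedPairList π k xs
  orderedPairList = xs↭ , AllPairs-byIndex xs (λ s s′ s<s′ s′< → ordered s s′ s<s′ (subst (s′ <_) length-xs s′<))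
    where
    posB-nth : ∀ s → s < k₀ → posB π (nth xs s) ≡ indexOf (end s) M
    posB-nth s s<k₀ = trans (cong (posB π) (sym (u-xs s s<k₀))) (posB≡ _ (≤-trans (s≤s z≤n) (proj₁ range)) (proj₂ range))
      where
      range = u-inner-range (suc s) (s≤s z≤n) (s≤s s<k₀)
    ordered : ∀ s s′ → s < s′ → s′ < k₀ → posB π (nth xs s) < posB π (nth xs s′)
    ordered s s′ s<s′ s′<k₀ = subst₂ _<_ (sym (posB-nth s (<-trans s<s′ s′<k₀))) (sym (posB-nth s′ s′<k₀))
      (M-order s s′ s<s′ (≤-trans s′<k₀ (n≤1+n _)) (end∈block s) (end∈block s′))

  mergeGraph≡H : ∀ i j → MergeEdge π k i j ⇔ ((i , j) ∈ H)
  mergeGraph≡H i j = mk⇔ to from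
    where
    to : MergeEdge π k i j → (i , j) ∈ H
    to (1≤i , i≤k , 1≤j , j≤k , eq) = label+1⇒edge i j (trans (cong (_+ 1) (sym (b≡β i 1≤i i≤k))) (trans eq (b≡β j 1≤j j≤k)))
    from : (i , j) ∈ H → MergeEdge π k i j
    from ij∈ = 1≤i , i≤k , 1≤j , j≤k , trans (cong (_+ 1) (b≡β i 1≤i i≤k)) (trans (edge⇒label+1 i j ij∈) (sym (b≡β j 1≤j j≤k)))
      where
      1≤i = proj₁ (H⊆τ i j ij∈)
      i≤k = proj₁ (proj₂ (H⊆τ i j ij∈))
      1≤j = proj₁ (H-target-range i j ij∈)
      j≤k = proj₂ (H-target-range i j ij∈)

realise : ∀ k → 1 ≤ k → ∀ xs → xs ↭ from2to k → (H : List Edge) →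
          (∀ i j → (i , j) ∈ H → TauEdge k xs i j) → ¬ HasDirectedCycle (λ i j → (i , j) ∈ H) →
          Σ ℕ (λ n → Σ (Permutation′ n) (λ π →
            PileSize π k × OrderedPairList π k xs × (∀ i j → MergeEdge π k i j ⇔ ((i , j) ∈ H))))
realise (suc k₀) _ xs xs↭ H H⊆τ acyclic =
  _ , π , pileSize , orderedPairList , mergeGraph≡H
  where open Construction k₀ xs xs↭ H H⊆τ acyclic

lemma5p6 : ((n : ℕ) (π : Permutation′ n) (k : ℕ) → 1 ≤ k → PileSize π k →
    (xs : List ℕ) → OrderedPairList π k xs →
    ((i j : ℕ) → MergeEdge π k i j → TauEdge k xs i j)
    × ¬ HasDirectedCycle (MergeEdge π k))
    ×
    ((k : ℕ) → 1 ≤ k → (xs : List ℕ) → xs ↭ from2to k →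
    (H : List (Σ ℕ (λ _ → ℕ))) →
    ((i j : ℕ) → (i , j) ∈ H → TauEdge k xs i j) →
    ¬ HasDirectedCycle (λ i j → (i , j) ∈ H) →
    Σ ℕ (λ n → Σ (Permutation′ n) (λ π →
    PileSize π k × OrderedPairList π k xs
    × ((i j : ℕ) → MergeEdge π k i j ⇔ ((i , j) ∈ H)))))
lemma5p6 =
  (λ n π k k≥1 pile xs opl → mergeGraph⊆tauGraph n π k k≥1 pile xs opl , mergeGraph-acyclic π k) ,
  realise
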